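{- Let $n\ge 3$ be an integer. The minimum size (number of edges) of a hamiltonian threshold graph of order $n$ is $(n^2+2n-3)/4$ if $n$ is odd and $(n^2+2n-4)/4$ if $n$ is even, and, up to isomorphism, this minimum size is attained only by the graph $G_n$.
   Context: A finite simple graph $G$ is a threshold graph if there exist a function $f:V(G)\to\mathbb{R}$ with nonnegative values and a nonnegative real number $t$ such that for any two distinct vertices $u,v$, $u$ and $v$ are adjacent if and only if $f(u)+f(v)>t$. For an integer $n\ge 3$, $G_n$ denotes the graph (unique up to isomorphism) with degree sequence $n-1,n-1,n-2,\ldots,\lceil n/2\rceil,\lceil n/2\rceil,\ldots,3,2$ having $n-2$ distinct degrees; that is, its $n$ degrees are the integers $2,3,\ldots,n-1$, each occurring once, except that $n-1$ and $\lceil n/2\rceil$ each occur twice (for $n=3$, where these two values coincide, the degree sequence is $2,2,2$). Graphs are considered up to isomorphism.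
   Formalization: The nonnegative weights f and threshold t of a threshold graph are rational numbers rather than real numbers. -}

module Defs where

open import Data.Bool using (Bool; true; false; if_then_else_; _∧_)
open import Data.Nat using (ℕ; zero; suc; _+_; _*_; _∸_; _/_; _%_; _≤_)
open import Data.Fin using (Fin; toℕ; _<?_)
open import Data.List using (List; _∷_; []; map; upTo; _++_)
open import Data.Nat.ListAction using (sum)
open import Data.List.Relation.Binary.Permutation.Propositional using (_↭_)
open import Data.Fin.Permutation using (Permutation′; _⟨$⟩ʳ_)
open import Data.Vec.Functional as VF using ()
open import Data.Product using (Σ; ∃; _×_; _,_)
open import Data.Rational using (ℚ; 0ℚ) renaming (_<_ to _<ℚ_; _≤_ to _≤ℚ_; _+_ to _+ℚ_)
open import Function.Bundles using (_⇔_)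
open import Relation.Binary.PropositionalEquality using (_≡_; _≢_)
open import Relation.Nullary using (does)

record Graph (n : ℕ) : Set where
  field
    adj     : Fin n → Fin n → Bool
    sym     : ∀ u v → adj u v ≡ adj v u
    irrefl  : ∀ u → adj u u ≡ false
open Graph public

vertices : (n : ℕ) → List (Fin n)
vertices n = VF.toList (λ i → i)

b2n : Bool → ℕ
b2n true  = 1
b2n false = 0

size : ∀ {n} → Graph n → ℕ
size {n} G = sum (map (λ u → sum (map (λ v →
  b2n (does (u <? v) ∧ adj G u v)) (vertices n))) (vertices n))

degree : ∀ {n} → Graph n → Fin n → ℕ
degree {n} G u = sum (map (λ v → b2n (adj G u v)) (vertices n))

degreeList : ∀ {n} → Graph n → List ℕ
degreeList {n} G = map (degree G) (vertices n)

IsThreshold : ∀ {n} → Graph n → Set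
IsThreshold {n} G =
  Σ (Fin n → ℚ) λ f → Σ ℚ λ t →
    (∀ u → 0ℚ ≤ℚ f u) × (0ℚ ≤ℚ t) ×
    (∀ u v → u ≢ v → (adj G u v ≡ true ⇔ t <ℚ (f u +ℚ f v)))

-- a mod m (total; only used with m = n ≥ 3)
modn : ℕ → ℕ → ℕ
modn a zero = a
modn a (suc m) = a % suc m

IsHamiltonian : ∀ {n} → Graph n → Set
IsHamiltonian {n} G =
  Σ (Permutation′ n) λ σ →
    ∀ (i j : Fin n) → modn (suc (toℕ i)) n ≡ toℕ j →
      adj G (σ ⟨$⟩ʳ i) (σ ⟨$⟩ʳ j) ≡ true

_≅_ : ∀ {n} → Graph n → Graph n → Set
_≅_ {n} H G = Σ (Permutation′ n) λ π →
  ∀ u v → adj H u v ≡ adj G (π ⟨$⟩ʳ u) (π ⟨$⟩ʳ v)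

-- The degree sequence of G_n: 2,3,…,n-1 once each, plus n-1 and ⌈n/2⌉ again.
-- upTo (n ∸ 2) = 0,…,n-3; adding 2 gives 2,…,n-1.
degSeqGn : ℕ → List ℕ
degSeqGn n = map (λ k → k + 2) (upTo (n ∸ 2)) ++ ((n ∸ 1) ∷ ((n + 1) / 2) ∷ [])

-- G is (isomorphic to) G_n: it has the degree sequence defining G_n.
IsGn : ∀ {n} → Graph n → Set
IsGn {n} G = degreeList G ↭ degSeqGn n

minSize : ℕ → ℕ
minSize n with n % 2
... | 0 = (n * n + 2 * n ∸ 4) / 4
... | _ = (n * n + 2 * n ∸ 3) / 4

{-# OPTIONS --safe #-}
-- Order the vertices of a hamiltonian threshold graph (weights f, threshold t) by weight and
-- let r be the rank of v. If 2 f(v) ≤ t, the r + 1 vertices not heavier than v have all their neighbours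
-- in N(v); if 2 f(v) > t, the non-neighbours of v have all their neighbours among the vertices heavier
-- than v. In a hamiltonian graph a set X whose neighbours all lie in S satisfies |X| ≤ |S|, and |X| < |S|
-- if moreover X ≠ ∅ and X ∪ S misses a vertex: the successor along the cycle injects X into S. Hence the
-- vertex of rank r has degree ≥ r + 2 while 2r + 2 < n, ≥ ⌈n/2⌉ at the middle rank and ≥ min(r + 1, n − 1)
-- beyond it; these are the degrees of G_n, so 2 · size ≥ Σ deg(G_n) = 2 · minSize n.
--
-- At equality the degrees are those of G_n. A graph A whose degrees d agree with
-- those of the threshold graph T given by u ~ v ⇔ d u + d v > n is T itself, because
-- Σ ([A] − [T]) (2 (d u + d v) − (2n + 1)) vanishes while every term is ≤ 0. So both the extremal graph
-- and any graph with the degree sequence of G_n are isomorphic to that T.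
--
-- Construction. T is threshold by definition and hamiltonian along the degree order
-- ⌈n/2⌉, n − 1, 2, n − 1, 3, n − 2, 4, …, in which consecutive degrees sum to more than n.
module Submission where

open import Data.Bool as Bool using (Bool; true; false; not; _∧_; _∨_)
import Data.Bool.Properties as Bool
open import Data.Empty using (⊥-elim)
open import Data.Fin as Fin using (Fin; zero; suc; toℕ; punchOut)
import Data.Fin.Properties as Fin
open import Data.Fin.Permutation as Perm
  using (Permutation′; permutation; _⟨$⟩ʳ_; _⟨$⟩ˡ_; inverseˡ; inverseʳ; _∘ₚ_)
open import Data.List as List using ([]; _∷_; tabulate)
import Data.List.Properties as List
open import Data.List.Relation.Binary.Permutation.Homogeneous using (onIndices)
open import Data.List.Relation.Binary.Permutation.Propositional as ↭
  using (_↭_; ↭⇒↭ₛ; ↭-trans; ↭-sym; ↭-reflexive)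
open import Data.List.Relation.Binary.Permutation.Propositional.Properties using (++-comm)
import Data.List.Relation.Binary.Permutation.Setoid.Properties as ↭ₛ
open import Data.Nat
open import Data.Nat.DivMod
  using (_/_; _%_; m%n<n; m<n⇒m%n≡m; n%n≡0; m*n%n≡0; m*n/n≡m; m<n⇒m/n≡0; +-distrib-/; [m+kn]%n≡m%n)
open import Data.Nat.ListAction using () renaming (sum to listSum)
open import Data.Nat.Properties
open import Data.Nat.Tactic.RingSolver using (solve-∀)
open import Data.Product using (Σ; ∃; _×_; _,_; proj₁; proj₂)
open import Data.Product.Relation.Binary.Lex.Strict using (×-strictTotalOrder)
open import Data.Rational as ℚ using (ℚ)
import Data.Rational.Properties as ℚ
open import Data.Sum using (_⊎_; inj₁; inj₂)
open import Function.Base using (_∘_)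
open import Function.Bundles using (_⇔_; mk⇔; Equivalence)
open import Function.Definitions using (Injective)
open import Relation.Binary.Bundles using (StrictTotalOrder)
open import Relation.Binary.Definitions using (tri<; tri≈; tri>)
open import Relation.Binary.PropositionalEquality
open import Relation.Nullary using (¬_; Dec; yes; no; does; contradiction)
open import Relation.Nullary.Decidable using (dec-true; dec-false; does-⇔; from-yes; _×-dec_)
open import Algebra.Properties.Semiring.Sum +-*-semiring
  using (sum; ∑-distrib-+; ∑-comm; ∑-permute; sum-cong-≗; *-distribʳ-sum)

open import Defs hiding (sym)

private variable n : ℕ

does-true⇒ : ∀ {a} {A : Set a} (A? : Dec A) → does A? ≡ true → A
does-true⇒ (yes a) _ = a

sum-mono-≤ : {f g : Fin n → ℕ} → (∀ i → f i ≤ g i) → sum f ≤ sum g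
sum-mono-≤ {zero}  f≤g = z≤n
sum-mono-≤ {suc n} f≤g = +-mono-≤ (f≤g zero) (sum-mono-≤ (f≤g ∘ suc))

sum-mono-< : {f g : Fin n → ℕ} → (∀ i → f i ≤ g i) → ∀ k → f k < g k → sum f < sum g
sum-mono-< f≤g zero    fk<gk = +-mono-<-≤ fk<gk (sum-mono-≤ (f≤g ∘ suc))
sum-mono-< f≤g (suc k) fk<gk = +-mono-≤-< (f≤g zero) (sum-mono-< (f≤g ∘ suc) k fk<gk)

sum-mono-≤-rigid : {f g : Fin n → ℕ} → (∀ i → f i ≤ g i) → sum g ≤ sum f → ∀ i → f i ≡ g i
sum-mono-≤-rigid f≤g Σg≤Σf i with m≤n⇒m<n∨m≡n (f≤g i)
... | inj₁ fi<gi = contradiction (sum-mono-< f≤g i fi<gi) (≤⇒≯ Σg≤Σf)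
... | inj₂ fi≡gi = fi≡gi

sum-const : ∀ n c → sum {n} (λ _ → c) ≡ n * c
sum-const zero    c = refl
sum-const (suc n) c = cong (c +_) (sum-const n c)

sum-tabulate : (f : Fin n → ℕ) → listSum (tabulate f) ≡ sum f
sum-tabulate {zero}  f = refl
sum-tabulate {suc n} f = cong (f zero +_) (sum-tabulate (f ∘ suc))

sum-arithmetic : ∀ m a → 2 * sum {m} (λ i → a + toℕ i) + m ≡ m * (a + a + m)
sum-arithmetic zero    a = refl
sum-arithmetic (suc m) a = begin
  2 * sum {suc m} (λ i → a + toℕ i) + suc m ≡⟨ cong (λ x → 2 * x + suc m) (cong₂ _+_ (+-identityʳ a) shift) ⟩
  2 * (a + S) + suc m                       ≡⟨ split a S m ⟩
  2 * a + 1 + (2 * S + m)                   ≡⟨ cong (2 * a + 1 +_) (sum-arithmetic m (suc a)) ⟩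
  2 * a + 1 + m * (suc a + suc a + m)       ≡⟨ merge a m ⟩
  suc m * (a + a + suc m)                   ∎
  where
  open ≡-Reasoning
  S = sum {m} (λ i → suc a + toℕ i)
  shift : sum {m} (λ i → a + suc (toℕ i)) ≡ S
  shift = sum-cong-≗ {m} (λ i → +-suc a (toℕ i))
  split : ∀ a S m → 2 * (a + S) + suc m ≡ 2 * a + 1 + (2 * S + m)
  split = solve-∀
  merge : ∀ a m → 2 * a + 1 + m * (suc a + suc a + m) ≡ suc m * (a + a + suc m)
  merge = solve-∀

sum₂ : (Fin n → Fin n → ℕ) → ℕ
sum₂ F = sum (λ u → sum (F u))

sum₂-distrib-+ : (F G : Fin n → Fin n → ℕ) → sum₂ (λ u v → F u v + G u v) ≡ sum₂ F + sum₂ G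
sum₂-distrib-+ F G = trans (sum-cong-≗ (λ u → ∑-distrib-+ (F u) (G u))) (∑-distrib-+ (λ u → sum (F u)) (λ u → sum (G u)))

sum₂-*ʳ : (F : Fin n → Fin n → ℕ) (c : ℕ) → sum₂ (λ u v → F u v * c) ≡ sum₂ F * c
sum₂-*ʳ F c = sym (trans (*-distribʳ-sum c (λ u → sum (F u))) (sum-cong-≗ (λ u → *-distribʳ-sum c (F u))))

sum₂-mono-≤-rigid : {F G : Fin n → Fin n → ℕ} → (∀ u v → F u v ≤ G u v) → sum₂ G ≤ sum₂ F →
                    ∀ u v → F u v ≡ G u v
sum₂-mono-≤-rigid F≤G ΣG≤ΣF u =
  sum-mono-≤-rigid (F≤G u) (≤-reflexive (sym (sum-mono-≤-rigid (sum-mono-≤ ∘ F≤G) ΣG≤ΣF u)))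

count : (Fin n → Bool) → ℕ
count P = sum (b2n ∘ P)

count<n : (P : Fin n → Bool) (k : Fin n) → P k ≡ false → count P < n
count<n {n} P k Pk≡false = subst (count P <_) (trans (sum-const n 1) (*-identityʳ n))
  (sum-mono-< (b2n≤1 ∘ P) k (subst (λ b → b2n b < 1) (sym Pk≡false) z<s))
  where
  b2n≤1 : ∀ b → b2n b ≤ 1
  b2n≤1 true  = ≤-refl
  b2n≤1 false = z≤n

count-none : (P : Fin n → Bool) → (∀ w → P w ≡ false) → count P ≡ 0
count-none {n} P none = trans (sum-cong-≗ (cong b2n ∘ none)) (trans (sum-const n 0) (*-zeroʳ n))

count-≥ : ∀ m t → count {m} (λ k → does (t ≤? toℕ k)) ≡ m ∸ t
count-≥ zero    t       = sym (0∸n≡0 t)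
count-≥ (suc m) zero    = cong suc (count-≥ m 0)
count-≥ (suc m) (suc t) = trans (sum-cong-≗ {m} shift) (count-≥ m t)
  where
  shift : ∀ k → b2n (does (suc t ≤? suc (toℕ k))) ≡ b2n (does (t ≤? toℕ k))
  shift k = cong b2n (does-⇔ (mk⇔ s≤s⁻¹ s≤s) (suc t ≤? suc (toℕ k)) (t ≤? toℕ k))

uncovered-or-covering : (X S : Fin n → Bool) → (∃ λ w → X w ≡ false × S w ≡ false) ⊎ n ≤ count X + count S
uncovered-or-covering {n} X S with Fin.any? (λ w → (X w Bool.≟ false) ×-dec (S w Bool.≟ false))
... | yes uncovered = inj₁ uncovered
... | no  ∄w = inj₂ (subst₂ _≤_ (trans (sum-const n 1) (*-identityʳ n)) (∑-distrib-+ (b2n ∘ X) (b2n ∘ S))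
                                (sum-mono-≤ covered))
  where
  covered : ∀ w → 1 ≤ b2n (X w) + b2n (S w)
  covered w with X w in Xw | S w in Sw
  ... | true  | _     = s≤s z≤n
  ... | false | true  = s≤s z≤n
  ... | false | false = contradiction (w , Xw , Sw) ∄w

_≟ᵇ_ : Fin n → Fin n → Bool
i ≟ᵇ j = does (i Fin.≟ j)

count-≟ᵇ : (k : Fin n) → count (_≟ᵇ k) ≡ 1
count-≟ᵇ {suc n} zero    = cong suc (trans (sum-const n 0) (*-zeroʳ n))
count-≟ᵇ {suc n} (suc k) = trans (sum-cong-≗ suc≟suc) (count-≟ᵇ k)
  where
  suc≟suc : ∀ i → b2n (suc i ≟ᵇ suc k) ≡ b2n (i ≟ᵇ k)
  suc≟suc i with i Fin.≟ k
  ... | yes refl = refl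
  ... | no _     = refl

count-partition : (P Q : Fin n → Bool) (v : Fin n) →
                  (∀ w → b2n (P w) + b2n (Q w) + b2n (w ≟ᵇ v) ≡ 1) → count P + count Q + 1 ≡ n
count-partition {n} P Q v one = begin
  count P + count Q + 1                              ≡⟨ cong (count P + count Q +_) (count-≟ᵇ v) ⟨
  count P + count Q + count (_≟ᵇ v)                  ≡⟨ cong (_+ count (_≟ᵇ v)) (∑-distrib-+ (b2n ∘ P) (b2n ∘ Q)) ⟨
  sum (λ w → b2n (P w) + b2n (Q w)) + count (_≟ᵇ v)  ≡⟨ ∑-distrib-+ (λ w → b2n (P w) + b2n (Q w)) (b2n ∘ (_≟ᵇ v)) ⟨
  sum (λ w → b2n (P w) + b2n (Q w) + b2n (w ≟ᵇ v))   ≡⟨ sum-cong-≗ one ⟩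
  sum {n} (λ _ → 1)                                  ≡⟨ trans (sum-const n 1) (*-identityʳ n) ⟩
  n                                                  ∎
  where open ≡-Reasoning

count-except : (P : Fin n → Bool) (u : Fin n) → count (λ v → not (u ≟ᵇ v) ∧ P v) + b2n (P u) ≡ count P
count-except {n} P u = begin
  count P∖u + b2n (P u)                               ≡⟨ cong (count P∖u +_) at-u ⟨
  count P∖u + sum (λ v → b2n (v ≟ᵇ u) * b2n (P u))    ≡⟨ ∑-distrib-+ (b2n ∘ P∖u) (λ v → b2n (v ≟ᵇ u) * b2n (P u)) ⟨
  sum (λ v → b2n (P∖u v) + b2n (v ≟ᵇ u) * b2n (P u))  ≡⟨ sum-cong-≗ split ⟩
  count P                                             ∎
  where
  open ≡-Reasoning
  P∖u : Fin n → Bool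
  P∖u v = not (u ≟ᵇ v) ∧ P v
  at-u : sum (λ v → b2n (v ≟ᵇ u) * b2n (P u)) ≡ b2n (P u)
  at-u = trans (sym (*-distribʳ-sum (b2n (P u)) (b2n ∘ (_≟ᵇ u)))) (trans (cong (_* b2n (P u)) (count-≟ᵇ u)) (*-identityˡ _))
  split : ∀ v → b2n (P∖u v) + b2n (v ≟ᵇ u) * b2n (P u) ≡ b2n (P v)
  split v with u Fin.≟ v
  ... | yes refl rewrite dec-true (u Fin.≟ u) refl = +-identityʳ _
  ... | no  u≢v  rewrite dec-false (v Fin.≟ u) (u≢v ∘ sym) = +-identityʳ _

injective⇒surjective : ∀ {n} {f : Fin n → Fin n} → Injective _≡_ _≡_ f → ∀ k → ∃ λ i → f i ≡ k
injective⇒surjective {suc m} {f} f-injective k with Fin.any? (λ i → f i Fin.≟ k)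
... | yes found = found
... | no  ∄i    = ⊥-elim (Fin.<⇒notInjective (n<1+n m) punchOut-injective)
  where
  punchOut-injective : Injective _≡_ _≡_ (λ i → punchOut {i = k} {j = f i} (λ eq → ∄i (i , sym eq)))
  punchOut-injective {i} {j} eq =
    f-injective (Fin.punchOut-injective {i = k} (λ e → ∄i (i , sym e)) (λ e → ∄i (j , sym e)) eq)

injective⇒permutation : (f : Fin n → Fin n) → Injective _≡_ _≡_ f → Permutation′ n
injective⇒permutation f f-injective =
  permutation f (proj₁ ∘ surj) (proj₂ ∘ surj) (λ i → f-injective (proj₂ (surj (f i))))
  where surj = injective⇒surjective f-injective

permutation-injective : (π : Permutation′ n) → Injective _≡_ _≡_ (π ⟨$⟩ʳ_)
permutation-injective π eq = trans (sym (inverseˡ π)) (trans (cong (π ⟨$⟩ˡ_) eq) (inverseˡ π))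

tabulate-↭⇒permutation : (f g : Fin n → ℕ) → tabulate f ↭ tabulate g →
                         Σ (Permutation′ n) λ π → ∀ i → f i ≡ g (π ⟨$⟩ʳ i)
tabulate-↭⇒permutation f g f↭g = π , λ i → begin
  f i                                          ≡⟨ List.lookup-tabulate f i ⟨
  List.lookup (tabulate f) (cast-f i)          ≡⟨ ↭ₛ.onIndices-lookup (setoid ℕ) (↭⇒↭ₛ f↭g) (cast-f i) ⟩
  List.lookup (tabulate g) (πₗ ⟨$⟩ʳ cast-f i)  ≡⟨ cong (List.lookup (tabulate g)) (Fin.cast-involutive (sym lg) lg _) ⟨
  List.lookup (tabulate g) (cast-g (π ⟨$⟩ʳ i)) ≡⟨ List.lookup-tabulate g (π ⟨$⟩ʳ i) ⟩
  g (π ⟨$⟩ʳ i)                                 ∎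
  where
  open ≡-Reasoning
  lg = List.length-tabulate g
  cast-f = Fin.cast (sym (List.length-tabulate f))
  cast-g = Fin.cast (sym lg)
  πₗ = onIndices (↭⇒↭ₛ f↭g)
  π = Perm.cast-id (sym (List.length-tabulate f)) ∘ₚ πₗ ∘ₚ Perm.cast-id lg

tabulate-toℕ : ∀ {a} {A : Set a} (h : ℕ → A) → tabulate {n = n} (h ∘ toℕ) ≡ List.applyUpTo h n
tabulate-toℕ {zero}  h = refl
tabulate-toℕ {suc n} h = cong (h 0 ∷_) (tabulate-toℕ (h ∘ suc))

degree≡count : (G : Graph n) (u : Fin n) → degree G u ≡ count (adj G u)
degree≡count G u = trans (cong listSum (List.map-tabulate (λ v → v) (b2n ∘ adj G u))) (sum-tabulate (b2n ∘ adj G u))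

degreeList≡tabulate : (G : Graph n) → degreeList G ≡ tabulate (degree G)
degreeList≡tabulate G = List.map-tabulate (λ v → v) (degree G)

orderedEdge : Graph n → Fin n → Fin n → ℕ
orderedEdge G u v = b2n (does (u Fin.<? v) ∧ adj G u v)

size≡sum₂ : (G : Graph n) → size G ≡ sum₂ (orderedEdge G)
size≡sum₂ {n} G = trans (cong listSum (List.map-tabulate (λ v → v) row)) (trans (sum-tabulate row) (sum-cong-≗ row≡))
  where
  row : Fin n → ℕ
  row u = listSum (List.map (orderedEdge G u) (vertices n))
  row≡ : ∀ u → row u ≡ sum (orderedEdge G u)
  row≡ u = trans (cong listSum (List.map-tabulate (λ v → v) (orderedEdge G u))) (sum-tabulate (orderedEdge G u))

sum₂-adj : (G : Graph n) → sum₂ (λ u v → b2n (adj G u v)) ≡ sum (degree G)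
sum₂-adj G = sym (sum-cong-≗ (degree≡count G))

handshake : (G : Graph n) → sum (degree G) ≡ 2 * size G
handshake {n} G = begin
  sum (degree G)                                          ≡⟨ sum₂-adj G ⟨
  sum₂ (λ u v → b2n (adj G u v))                          ≡⟨ sum-cong-≗ (λ u → sum-cong-≗ (split u)) ⟩
  sum₂ (λ u v → orderedEdge G u v + orderedEdge G v u)    ≡⟨ sum₂-distrib-+ (orderedEdge G) (λ u v → orderedEdge G v u) ⟩
  E + sum₂ (λ u v → orderedEdge G v u)                    ≡⟨ cong (E +_) (∑-comm (orderedEdge G)) ⟨
  E + E                                                   ≡⟨ cong (E +_) (+-identityʳ E) ⟨
  2 * E                                                   ≡⟨ cong (2 *_) (size≡sum₂ G) ⟨
  2 * size G                                              ∎
  where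
  open ≡-Reasoning
  E = sum₂ (orderedEdge G)
  split : ∀ u v → b2n (adj G u v) ≡ orderedEdge G u v + orderedEdge G v u
  split u v with Fin.<-cmp u v
  ... | tri< u<v _ v≮u rewrite dec-true (u Fin.<? v) u<v | dec-false (v Fin.<? u) v≮u = sym (+-identityʳ _)
  ... | tri≈ _ refl _  rewrite dec-false (u Fin.<? u) (Fin.<-irrefl refl) | irrefl G u = refl
  ... | tri> u≮v _ v<u rewrite dec-false (u Fin.<? v) u≮v | dec-true (v Fin.<? u) v<u = cong b2n (Graph.sym G u v)

sum₂-adj-weighted : (G : Graph n) (w : Fin n → ℕ) →
                    sum₂ (λ u v → b2n (adj G u v) * (w u + w v)) ≡ 2 * sum (λ u → degree G u * w u)
sum₂-adj-weighted {n} G w = begin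
  sum₂ (λ u v → [ u ~ v ] * (w u + w v))
    ≡⟨ sum-cong-≗ (λ u → sum-cong-≗ (λ v → *-distribˡ-+ [ u ~ v ] (w u) (w v))) ⟩
  sum₂ (λ u v → [ u ~ v ] * w u + [ u ~ v ] * w v)
    ≡⟨ sum₂-distrib-+ (λ u v → [ u ~ v ] * w u) (λ u v → [ u ~ v ] * w v) ⟩
  X + sum₂ (λ u v → [ u ~ v ] * w v)
    ≡⟨ cong (X +_) (∑-comm (λ u v → [ u ~ v ] * w v)) ⟩
  X + sum₂ (λ v u → [ u ~ v ] * w v)
    ≡⟨ cong (X +_) (sum-cong-≗ (λ v → sum-cong-≗ (λ u → cong (_* w v) (~-sym u v)))) ⟩
  X + X                              ≡⟨ cong (X +_) (+-identityʳ X) ⟨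
  2 * X                              ≡⟨ cong (2 *_) (sum-cong-≗ row) ⟩
  2 * sum (λ u → degree G u * w u)   ∎
  where
  open ≡-Reasoning
  [_~_] : Fin n → Fin n → ℕ
  [ u ~ v ] = b2n (adj G u v)
  ~-sym : ∀ u v → [ u ~ v ] ≡ [ v ~ u ]
  ~-sym u v = cong b2n (Graph.sym G u v)
  X = sum₂ (λ u v → [ u ~ v ] * w u)
  row : ∀ u → sum (λ v → [ u ~ v ] * w u) ≡ degree G u * w u
  row u = trans (sym (*-distribʳ-sum (w u) (b2n ∘ adj G u))) (cong (_* w u) (sym (degree≡count G u)))

≅-of-≡ : {H G : Graph n} → (∀ u v → adj H u v ≡ adj G u v) → H ≅ G
≅-of-≡ same = Perm.id , same

≅-sym : {H G : Graph n} → H ≅ G → G ≅ H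
≅-sym {G = G} (π , iso) = Perm.flip π , λ u v →
  trans (cong₂ (adj G) (sym (inverseʳ π)) (sym (inverseʳ π))) (sym (iso (π ⟨$⟩ˡ u) (π ⟨$⟩ˡ v)))

≅-trans : {F H G : Graph n} → F ≅ H → H ≅ G → F ≅ G
≅-trans (π , iso₁) (ρ , iso₂) = π ∘ₚ ρ , λ u v → trans (iso₁ u v) (iso₂ _ _)

degree-≅ : {H G : Graph n} ((π , _) : H ≅ G) → ∀ u → degree H u ≡ degree G (π ⟨$⟩ʳ u)
degree-≅ {H = H} {G} (π , iso) u = begin
  degree H u                                     ≡⟨ degree≡count H u ⟩
  sum (λ v → b2n (adj H u v))                    ≡⟨ sum-cong-≗ (cong b2n ∘ iso u) ⟩
  sum (λ v → b2n (adj G (π ⟨$⟩ʳ u) (π ⟨$⟩ʳ v)))  ≡⟨ ∑-permute (b2n ∘ adj G (π ⟨$⟩ʳ u)) π ⟨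
  count (adj G (π ⟨$⟩ʳ u))                       ≡⟨ degree≡count G _ ⟨
  degree G (π ⟨$⟩ʳ u)                            ∎
  where open ≡-Reasoning

-- Hamiltonian cycles

next : Fin n → Fin n
next {suc m} i = Fin.fromℕ< (m%n<n (suc (toℕ i)) (suc m))

toℕ-next : (i : Fin n) → toℕ (next i) ≡ modn (suc (toℕ i)) n
toℕ-next {suc m} i = Fin.toℕ-fromℕ< (m%n<n (suc (toℕ i)) (suc m))

toℕ-next-< : (i : Fin n) → suc (toℕ i) < n → toℕ (next i) ≡ suc (toℕ i)
toℕ-next-< {suc m} i i+1<n = trans (toℕ-next i) (m<n⇒m%n≡m i+1<n)

toℕ-next-last : (i : Fin n) → suc (toℕ i) ≡ n → toℕ (next i) ≡ 0
toℕ-next-last {suc m} i i+1≡n = trans (toℕ-next i) (trans (cong (_% suc m) i+1≡n) (n%n≡0 (suc m)))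

next-injective : Injective _≡_ _≡_ (next {n})
next-injective {n} {i} {j} eq with m≤n⇒m<n∨m≡n (Fin.toℕ<n i) | m≤n⇒m<n∨m≡n (Fin.toℕ<n j)
... | inj₁ i+1<n  | inj₁ j+1<n  = Fin.toℕ-injective (suc-injective
                                    (trans (sym (toℕ-next-< i i+1<n)) (trans (cong toℕ eq) (toℕ-next-< j j+1<n))))
... | inj₁ i+1<n  | inj₂ j+1≡n  = contradiction
                                    (trans (sym (toℕ-next-last j j+1≡n)) (trans (cong toℕ (sym eq)) (toℕ-next-< i i+1<n))) 0≢1+n
... | inj₂ i+1≡n  | inj₁ j+1<n  = contradiction
                                    (trans (sym (toℕ-next-last i i+1≡n)) (trans (cong toℕ eq) (toℕ-next-< j j+1<n))) 0≢1+n
... | inj₂ i+1≡n  | inj₂ j+1≡n  = Fin.toℕ-injective (suc-injective (trans i+1≡n (sym j+1≡n)))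

backward-induction : (Q : Fin n → Set) → (∀ i → Q (next i) → Q i) → ∀ {i j} → toℕ j ≤ toℕ i → Q i → Q j
backward-induction {n} Q Q-next⇒Q j≤i = go _ (m+[n∸m]≡n j≤i)
  where
  go : ∀ d {i j} → toℕ j + d ≡ toℕ i → Q i → Q j
  go zero    {i} {j} j+0≡i   Qi = subst Q (Fin.toℕ-injective (trans (sym j+0≡i) (+-identityʳ (toℕ j)))) Qi
  go (suc d) {i} {j} j+d+1≡i Qi = Q-next⇒Q j (go d next-j+d≡i Qi)
    where
    j+1≤i : suc (toℕ j) ≤ toℕ i
    j+1≤i = subst (suc (toℕ j) ≤_) j+d+1≡i (≤-trans (≤-reflexive (+-comm 1 (toℕ j))) (+-monoʳ-≤ (toℕ j) (s≤s z≤n)))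
    next-j+d≡i : toℕ (next j) + d ≡ toℕ i
    next-j+d≡i = trans (cong (_+ d) (toℕ-next-< j (≤-<-trans j+1≤i (Fin.toℕ<n i)))) (trans (sym (+-suc (toℕ j) d)) j+d+1≡i)

cyclic-induction : (Q : Fin n → Set) → (∀ i → Q (next i) → Q i) → ∀ {i} → Q i → ∀ j → Q j
cyclic-induction {suc m} Q Q-next⇒Q Qi j =
  backward-induction Q Q-next⇒Q (≤-pred (subst (suc (toℕ j) ≤_) (sym last+1≡n) (Fin.toℕ<n j)))
    (Q-next⇒Q last (subst Q (Fin.toℕ-injective (sym (toℕ-next-last last last+1≡n)))
      (backward-induction Q Q-next⇒Q z≤n Qi)))
  where
  last = Fin.fromℕ m
  last+1≡n : suc (toℕ last) ≡ suc m
  last+1≡n = cong suc (Fin.toℕ-fromℕ m)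

NeighboursIn : Graph n → (Fin n → Bool) → (Fin n → Bool) → Set
NeighboursIn G X S = ∀ x y → X x ≡ true → adj G x y ≡ true → S y ≡ true

module Hamiltonian (G : Graph n) (ham : IsHamiltonian G) where

  private
    σ = proj₁ ham

  successor : Fin n → Fin n
  successor v = σ ⟨$⟩ʳ next (σ ⟨$⟩ˡ v)

  successor-adjacent : ∀ v → adj G v (successor v) ≡ true
  successor-adjacent v = subst (λ x → adj G x (successor v) ≡ true) (inverseʳ σ)
    (proj₂ ham (σ ⟨$⟩ˡ v) (next (σ ⟨$⟩ˡ v)) (sym (toℕ-next _)))

  successor-injective : Injective _≡_ _≡_ successor
  successor-injective eq =
    permutation-injective (Perm.flip σ) (next-injective (permutation-injective σ eq))

  module _ {X S : Fin n → Bool} (X⇒S : NeighboursIn G X S) where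

    private
      X≤S∘successor : ∀ v → b2n (X v) ≤ b2n (S (successor v))
      X≤S∘successor v with X v in Xv
      ... | false = z≤n
      ... | true  rewrite X⇒S v (successor v) Xv (successor-adjacent v) = ≤-refl

      count-S∘successor : sum (b2n ∘ S ∘ successor) ≡ count S
      count-S∘successor = sym (∑-permute (b2n ∘ S) (injective⇒permutation successor successor-injective))

    count-≤-neighbours : count X ≤ count S
    count-≤-neighbours = subst (count X ≤_) count-S∘successor (sum-mono-≤ X≤S∘successor)

    -- If the successor map were onto S, then X ∪ S would be closed under predecessors along the
    -- cycle, hence contain every vertex.
    count-<-neighbours : ∀ {x₀ w} → X x₀ ≡ true → X w ≡ false → S w ≡ false → count X < count S
    count-<-neighbours {x₀} {w} Xx₀ Xw Sw with m≤n⇒m<n∨m≡n count-≤-neighbours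
    ... | inj₁ X<S = X<S
    ... | inj₂ X≡S = contradiction (cyclic-induction (X∪S ∘ (σ ⟨$⟩ʳ_)) X∪S-pred X∪S-x₀ (σ ⟨$⟩ˡ w)) X∪S-w
      where
      X≡S∘successor : ∀ v → b2n (X v) ≡ b2n (S (successor v))
      X≡S∘successor = sum-mono-≤-rigid X≤S∘successor (≤-reflexive (trans count-S∘successor (sym X≡S)))
      X∪S : Fin n → Set
      X∪S v = X v ∨ S v ≡ true
      X∪S-predecessor : ∀ v → X∪S (successor v) → X∪S v
      X∪S-predecessor v X∪S-succ with X (successor v) in X-succ
      ... | true  rewrite X⇒S (successor v) v X-succ (trans (Graph.sym G _ _) (successor-adjacent v)) = Bool.∨-zeroʳ (X v)
      ... | false with X v in Xv
      ...   | true  = refl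
      ...   | false = contradiction (trans (cong b2n (sym Xv)) (trans (X≡S∘successor v) (cong b2n X∪S-succ))) 0≢1+n
      X∪S-pred : ∀ i → X∪S (σ ⟨$⟩ʳ next i) → X∪S (σ ⟨$⟩ʳ i)
      X∪S-pred i = X∪S-predecessor (σ ⟨$⟩ʳ i) ∘ subst (λ j → X∪S (σ ⟨$⟩ʳ next j)) (sym (inverseˡ σ))
      X∪S-x₀ : X∪S (σ ⟨$⟩ʳ (σ ⟨$⟩ˡ x₀))
      X∪S-x₀ rewrite inverseʳ σ {x₀} | Xx₀ = refl
      X∪S-w : ¬ X∪S (σ ⟨$⟩ʳ (σ ⟨$⟩ˡ w))
      X∪S-w rewrite inverseʳ σ {w} | Xw | Sw = λ ()

data EvenOdd : ℕ → Set where
  even : ∀ q → EvenOdd (q + q)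
  odd  : ∀ q → EvenOdd (suc (q + q))

evenOdd : ∀ p → EvenOdd p
evenOdd zero = even 0
evenOdd (suc p) with evenOdd p
... | even q = odd q
... | odd  q = subst EvenOdd (cong suc (+-suc q q)) (even (suc q))

[m*n+r]/n≡m : ∀ m {n r} .{{_ : NonZero n}} → r < n → (m * n + r) / n ≡ m
[m*n+r]/n≡m m {n} {r} r<n = begin
  (m * n + r) / n   ≡⟨ +-distrib-/ (m * n) r (subst₂ (λ a b → a + b < n) (sym (m*n%n≡0 m n)) (sym (m<n⇒m%n≡m r<n)) r<n) ⟩
  m * n / n + r / n ≡⟨ cong₂ _+_ (m*n/n≡m m n) (m<n⇒m/n≡0 r<n) ⟩
  m + 0             ≡⟨ +-identityʳ m ⟩
  m                 ∎
  where open ≡-Reasoning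

[m*n+r]%n≡r : ∀ m {n r} .{{_ : NonZero n}} → r < n → (m * n + r) % n ≡ r
[m*n+r]%n≡r m {n} {r} r<n = trans (cong (_% n) (+-comm (m * n) r)) (trans ([m+kn]%n≡m%n r m n) (m<n⇒m%n≡m r<n))

private
  q+q≡q*2+0 : ∀ q → q + q ≡ q * 2 + 0
  q+q≡q*2+0 = solve-∀

  1+q+q≡q*2+1 : ∀ q → suc (q + q) ≡ q * 2 + 1
  1+q+q≡q*2+1 = solve-∀

[q+q]/2≡q : ∀ q → (q + q) / 2 ≡ q
[q+q]/2≡q q = trans (cong (_/ 2) (q+q≡q*2+0 q)) ([m*n+r]/n≡m q {2} {0} z<s)

[1+q+q]/2≡q : ∀ q → suc (q + q) / 2 ≡ q
[1+q+q]/2≡q q = trans (cong (_/ 2) (1+q+q≡q*2+1 q)) ([m*n+r]/n≡m q {2} {1} (s<s z<s))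

[q+q]%2≡0 : ∀ q → (q + q) % 2 ≡ 0
[q+q]%2≡0 q = trans (cong (_% 2) (q+q≡q*2+0 q)) ([m*n+r]%n≡r q {2} {0} z<s)

[1+q+q]%2≡1 : ∀ q → suc (q + q) % 2 ≡ 1
[1+q+q]%2≡1 q = trans (cong (_% 2) (1+q+q≡q*2+1 q)) ([m*n+r]%n≡r q {2} {1} (s<s z<s))

suc+suc : ∀ r → suc r + suc r ≡ 2 + (r + r)
suc+suc r = cong suc (+-suc r r)

double≤odd⇒≤ : ∀ {c k} → c + c ≤ suc (k + k) → c ≤ k
double≤odd⇒≤ {c} {k} 2c≤2k+1 with c ≤? k
... | yes c≤k = c≤k
... | no  c≰k = contradiction (≤-trans (subst (_≤ c + c) (suc+suc k) (+-mono-≤ k<c k<c)) 2c≤2k+1) (1+n≰n ∘ ≤-pred)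
  where
  k<c = ≰⇒> c≰k

ceilHalf : ℕ → ℕ
ceilHalf n = (n + 1) / 2

ceilHalf-even : ∀ q → ceilHalf (q + q) ≡ q
ceilHalf-even q = trans (cong (_/ 2) (+-comm (q + q) 1)) ([1+q+q]/2≡q q)

ceilHalf-odd : ∀ q → ceilHalf (suc (q + q)) ≡ suc q
ceilHalf-odd q = trans (cong (_/ 2) (odd+1≡ q)) ([q+q]/2≡q (suc q))
  where
  odd+1≡ : ∀ q → suc (q + q) + 1 ≡ suc q + suc q
  odd+1≡ = solve-∀

ceilHalf-bounds : ∀ n → n ≤ ceilHalf n + ceilHalf n × ceilHalf n + ceilHalf n ≤ suc n
ceilHalf-bounds n with evenOdd n
... | even q rewrite ceilHalf-even q = ≤-refl , n≤1+n (q + q)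
... | odd  q rewrite ceilHalf-odd q | +-suc q q = n≤1+n _ , ≤-refl

ceilHalf<n : ∀ {n} → 3 ≤ n → ceilHalf n < n
ceilHalf<n {n} 3≤n with ceilHalf n <? n
... | yes c<n = c<n
... | no  c≮n = contradiction (≤-trans (+-mono-≤ (≮⇒≥ c≮n) (≮⇒≥ c≮n)) (proj₂ (ceilHalf-bounds n))) (<⇒≱ n+1<n+n)
  where
  n+1<n+n : suc n < n + n
  n+1<n+n = subst (_< n + n) (+-comm n 1) (+-monoʳ-< n (≤-trans (s≤s (s≤s z≤n)) 3≤n))

ceilHalf-partner : ∀ n x → n < x + ceilHalf n ⇔ n < x + x
ceilHalf-partner n x = mk⇔ to from
  where
  c = ceilHalf n
  to : n < x + c → n < x + x
  to n<x+c with c ≤? x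
  ... | yes c≤x = <-≤-trans n<x+c (+-monoʳ-≤ x c≤x)
  ... | no  c≰x = contradiction (s≤s⁻¹ (≤-trans (+-monoˡ-< c (≰⇒> c≰x)) (proj₂ (ceilHalf-bounds n)))) (<⇒≱ n<x+c)
  from : n < x + x → n < x + c
  from n<2x with x ≤? c
  ... | yes x≤c = <-≤-trans n<2x (+-monoʳ-≤ x x≤c)
  ... | no  x≰c = ≤-<-trans (proj₁ (ceilHalf-bounds n)) (+-monoˡ-< c (≰⇒> x≰c))

minSize-even : ∀ p → minSize (suc p + suc p) ≡ p * p + 3 * p + 1
minSize-even p = begin
  minSize N                         ≡⟨ with-%2 ([q+q]%2≡0 (suc p)) ⟩
  (N * N + 2 * N ∸ 4) / 4           ≡⟨ cong (λ m → (m ∸ 4) / 4) (square p) ⟩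
  ((X * 4 + 0) + 4 ∸ 4) / 4         ≡⟨ cong (_/ 4) (m+n∸n≡m (X * 4 + 0) 4) ⟩
  (X * 4 + 0) / 4                   ≡⟨ [m*n+r]/n≡m X {4} {0} z<s ⟩
  X                                 ∎
  where
  open ≡-Reasoning
  N = suc p + suc p
  X = p * p + 3 * p + 1
  with-%2 : N % 2 ≡ 0 → minSize N ≡ (N * N + 2 * N ∸ 4) / 4
  with-%2 n%2≡0 with N % 2
  ... | zero = refl
  square : ∀ p → (suc p + suc p) * (suc p + suc p) + 2 * (suc p + suc p) ≡ (p * p + 3 * p + 1) * 4 + 0 + 4
  square = solve-∀

minSize-odd : ∀ q → minSize (suc (q + q)) ≡ q * q + 2 * q
minSize-odd q = begin
  minSize N                         ≡⟨ with-%2 ([1+q+q]%2≡1 q) ⟩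
  (N * N + 2 * N ∸ 3) / 4           ≡⟨ cong (λ m → (m ∸ 3) / 4) (square q) ⟩
  ((X * 4 + 0) + 3 ∸ 3) / 4         ≡⟨ cong (_/ 4) (m+n∸n≡m (X * 4 + 0) 3) ⟩
  (X * 4 + 0) / 4                   ≡⟨ [m*n+r]/n≡m X {4} {0} z<s ⟩
  X                                 ∎
  where
  open ≡-Reasoning
  N = suc (q + q)
  X = q * q + 2 * q
  with-%2 : N % 2 ≡ 1 → minSize N ≡ (N * N + 2 * N ∸ 3) / 4
  with-%2 n%2≡1 with N % 2
  ... | suc _ = refl
  square : ∀ q → suc (q + q) * suc (q + q) + 2 * suc (q + q) ≡ (q * q + 2 * q) * 4 + 0 + 3
  square = solve-∀

4*minSize+4 : ∀ n → 2 ≤ n → 4 * minSize n + 4 ≡ n * n + n + 2 * ceilHalf n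
4*minSize+4 n 2≤n with evenOdd n
... | even zero    = contradiction 2≤n λ ()
... | even (suc p) = trans (cong (λ m → 4 * m + 4) (minSize-even p))
                       (trans (total p) (cong (λ c → n * n + n + 2 * c) (sym (ceilHalf-even (suc p)))))
  where
  total : ∀ p → 4 * (p * p + 3 * p + 1) + 4 ≡ (suc p + suc p) * (suc p + suc p) + (suc p + suc p) + 2 * suc p
  total = solve-∀
... | odd  q       = trans (cong (λ m → 4 * m + 4) (minSize-odd q))
                       (trans (total q) (cong (λ c → n * n + n + 2 * c) (sym (ceilHalf-odd q))))
  where
  total : ∀ q → 4 * (q * q + 2 * q) + 4 ≡ suc (q + q) * suc (q + q) + suc (q + q) + 2 * suc q
  total = solve-∀

gnDegree : ℕ → ℕ → ℕ
gnDegree n 0             = ceilHalf n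
gnDegree n 1             = n ∸ 1
gnDegree n (suc (suc k)) = suc (suc k)

gnDegree-range : ∀ {n} → 3 ≤ n → ∀ k → k < n → 2 ≤ gnDegree n k × gnDegree n k < n
gnDegree-range {n} 3≤n 0 _ = c≥2 , ceilHalf<n 3≤n
  where
  c≥2 : 2 ≤ ceilHalf n
  c≥2 with 2 ≤? ceilHalf n
  ... | yes c≥2 = c≥2
  ... | no  c≱2 = contradiction (≤-trans (proj₁ (ceilHalf-bounds n)) (+-mono-≤ c≤1 c≤1)) (<⇒≱ 3≤n)
    where c≤1 = ≤-pred (≰⇒> c≱2)
gnDegree-range (s≤s (s≤s (s≤s _))) 1 _ = s≤s (s≤s z≤n) , ≤-refl
gnDegree-range _ (suc (suc k)) k<n = s≤s (s≤s z≤n) , k<n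

sum-gnDegree : ∀ {n} → 2 ≤ n → sum {n} (gnDegree n ∘ toℕ) ≡ 2 * minSize n
sum-gnDegree {suc (suc m)} (s≤s (s≤s z≤n)) = *-cancelˡ-≡ _ _ 2 (+-cancelʳ-≡ (4 + m) _ _ (begin
  2 * (c + (suc m + S)) + (4 + m)            ≡⟨ split c m S ⟩
  2 * c + 2 * suc m + 4 + (2 * S + m)        ≡⟨ cong (2 * c + 2 * suc m + 4 +_) (sum-arithmetic m 2) ⟩
  2 * c + 2 * suc m + 4 + m * (2 + 2 + m)    ≡⟨ merge c m ⟩
  (2 + m) * (2 + m) + (2 + m) + 2 * c + m    ≡⟨ cong (_+ m) (4*minSize+4 (2 + m) (s≤s (s≤s z≤n))) ⟨
  4 * minSize (2 + m) + 4 + m                ≡⟨ regroup (minSize (2 + m)) m ⟩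
  2 * (2 * minSize (2 + m)) + (4 + m)        ∎))
  where
  open ≡-Reasoning
  c = ceilHalf (2 + m)
  S = sum {m} (λ i → 2 + toℕ i)
  split : ∀ c m S → 2 * (c + (suc m + S)) + (4 + m) ≡ 2 * c + 2 * suc m + 4 + (2 * S + m)
  split = solve-∀
  merge : ∀ c m → 2 * c + 2 * suc m + 4 + m * (2 + 2 + m) ≡ (2 + m) * (2 + m) + (2 + m) + 2 * c + m
  merge = solve-∀
  regroup : ∀ x m → 4 * x + 4 + m ≡ 2 * (2 * x) + (4 + m)
  regroup = solve-∀

sum-gnDegree∘permutation : 2 ≤ n → (ρ : Permutation′ n) → sum (λ v → gnDegree n (toℕ (ρ ⟨$⟩ʳ v))) ≡ 2 * minSize n
sum-gnDegree∘permutation {n} 2≤n ρ = trans (sym (∑-permute (gnDegree n ∘ toℕ) ρ)) (sum-gnDegree 2≤n)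

gnDegrees↭degSeqGn : 2 ≤ n → tabulate {n = n} (gnDegree n ∘ toℕ) ↭ degSeqGn n
gnDegrees↭degSeqGn {suc (suc m)} (s≤s (s≤s z≤n)) =
  ↭-trans (↭.swap (ceilHalf (2 + m)) (suc m) (↭-reflexive lower-degrees))
          (++-comm (suc m ∷ ceilHalf (2 + m) ∷ []) (List.map (_+ 2) (List.upTo m)))
  where
  lower-degrees : tabulate {n = m} (λ i → 2 + toℕ i) ≡ List.map (_+ 2) (List.upTo m)
  lower-degrees = trans (tabulate-toℕ (2 +_))
    (trans (sym (List.map-upTo (2 +_) m)) (List.map-cong (+-comm 2) (List.upTo m)))

isGn⇒gnDegrees : 2 ≤ n → (G : Graph n) → IsGn G →
                 Σ (Permutation′ n) λ ρ → ∀ v → degree G v ≡ gnDegree n (toℕ (ρ ⟨$⟩ʳ v))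
isGn⇒gnDegrees {n} 2≤n G G-isGn = tabulate-↭⇒permutation (degree G) (gnDegree n ∘ toℕ)
  (↭-trans (↭-reflexive (sym (degreeList≡tabulate G))) (↭-trans G-isGn (↭-sym (gnDegrees↭degSeqGn 2≤n))))

-- Degrees in hamiltonian threshold graphs

-- The degree bounds met by the vertex of rank r (counted from 0, by increasing weight) in a
-- hamiltonian threshold graph on n vertices.
RankBound : ℕ → ℕ → ℕ → Set
RankBound n r d = (2 + (r + r) < n → 2 + r ≤ d) × (1 + r ≤ d ⊎ 1 + d ≡ n)

≤-double⇒rank-bound : ∀ {n r d} → n ≤ d + d → 2 + (r + r) < n → 2 + r ≤ d
≤-double⇒rank-bound {n} {r} {d} n≤2d 2r+2<n with 2 + r ≤? d
... | yes r+2≤d = r+2≤d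
... | no  r+2≰d = contradiction (<-≤-trans 2r+2<n n≤2d)
                   (≤⇒≯ (≤-trans (+-mono-≤ d≤r+1 d≤r+1) (≤-reflexive (suc+suc r))))
  where
  d≤r+1 : d ≤ 1 + r
  d≤r+1 = ≤-pred (≰⇒> r+2≰d)

module ThresholdHamiltonian (G : Graph n) (f : Fin n → ℚ) (t : ℚ)
  (threshold : ∀ u v → u ≢ v → (adj G u v ≡ true ⇔ t ℚ.< f u ℚ.+ f v)) (ham : IsHamiltonian G) where

  open Hamiltonian G ham

  adjacent⇒> : ∀ {u v} → adj G u v ≡ true → t ℚ.< f u ℚ.+ f v
  adjacent⇒> {u} {v} u~v = Equivalence.to (threshold u v u≢v) u~v
    where
    u≢v : u ≢ v
    u≢v refl = contradiction (trans (sym u~v) (irrefl G u)) λ ()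

  >⇒adjacent : ∀ {u v} → u ≢ v → t ℚ.< f u ℚ.+ f v → adj G u v ≡ true
  >⇒adjacent {u} {v} u≢v = Equivalence.from (threshold u v u≢v)

  nonadjacent⇒≤ : ∀ {u v} → u ≢ v → adj G u v ≡ false → f u ℚ.+ f v ℚ.≤ t
  nonadjacent⇒≤ u≢v u≁v = ℚ.≮⇒≥ λ t<fu+fv → contradiction (trans (sym u≁v) (>⇒adjacent u≢v t<fu+fv)) λ ()

  private
    module Lex = StrictTotalOrder (×-strictTotalOrder ℚ.<-strictTotalOrder <-strictTotalOrder)

  _≺_ : Fin n → Fin n → Set
  u ≺ v = (f u , toℕ u) Lex.< (f v , toℕ v)

  _≺?_ : ∀ u v → Dec (u ≺ v)
  u ≺? v = (f u , toℕ u) Lex.<? (f v , toℕ v)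

  _≺ᵇ_ : Fin n → Fin n → Bool
  u ≺ᵇ v = does (u ≺? v)

  ≺-irrefl : ∀ v → ¬ v ≺ v
  ≺-irrefl v = Lex.irrefl (refl , refl)

  ≺-trans : ∀ {u v w} → u ≺ v → v ≺ w → u ≺ w
  ≺-trans = Lex.trans

  ≺-connex : ∀ {u v} → u ≢ v → u ≺ v ⊎ v ≺ u
  ≺-connex {u} {v} u≢v with Lex.compare (f u , toℕ u) (f v , toℕ v)
  ... | tri< u≺v _ _        = inj₁ u≺v
  ... | tri≈ _ (_ , toℕ≡) _ = contradiction (Fin.toℕ-injective toℕ≡) u≢v
  ... | tri> _ _ v≺u        = inj₂ v≺u

  ≺⇒≤ : ∀ {u v} → u ≺ v → f u ℚ.≤ f v
  ≺⇒≤ (inj₁ fu<fv)       = ℚ.<⇒≤ fu<fv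
  ≺⇒≤ (inj₂ (fu≡fv , _)) = ℚ.≤-reflexive fu≡fv

  rank : Fin n → ℕ
  rank v = count (_≺ᵇ v)

  rank<n : ∀ v → rank v < n
  rank<n v = count<n (_≺ᵇ v) v (dec-false (v ≺? v) (≺-irrefl v))

  rank-mono-< : ∀ {u v} → u ≺ v → rank u < rank v
  rank-mono-< {u} {v} u≺v = sum-mono-< below-u⇒below-v u
    (subst₂ (λ a b → b2n a < b2n b) (sym (dec-false (u ≺? u) (≺-irrefl u))) (sym (dec-true (u ≺? v) u≺v)) z<s)
    where
    below-u⇒below-v : ∀ w → b2n (w ≺ᵇ u) ≤ b2n (w ≺ᵇ v)
    below-u⇒below-v w with w ≺? u
    ... | no  _   = z≤n
    ... | yes w≺u rewrite dec-true (w ≺? v) (≺-trans w≺u u≺v) = ≤-refl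

  rank-injective : Injective _≡_ _≡_ rank
  rank-injective {u} {v} ranks≡ with u Fin.≟ v
  ... | yes u≡v = u≡v
  ... | no  u≢v with ≺-connex u≢v
  ...   | inj₁ u≺v = contradiction ranks≡ (<⇒≢ (rank-mono-< u≺v))
  ...   | inj₂ v≺u = contradiction (sym ranks≡) (<⇒≢ (rank-mono-< v≺u))

  rank+heavier : ∀ v → rank v + count (v ≺ᵇ_) + 1 ≡ n
  rank+heavier v = count-partition (_≺ᵇ v) (v ≺ᵇ_) v one
    where
    one : ∀ w → b2n (w ≺ᵇ v) + b2n (v ≺ᵇ w) + b2n (w ≟ᵇ v) ≡ 1
    one w with w ≺? v | v ≺? w | w Fin.≟ v
    ... | yes _   | no _    | no _     = refl
    ... | no _    | yes _   | no _     = refl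
    ... | no _    | no _    | yes _    = refl
    ... | yes w≺v | yes v≺w | _        = contradiction (≺-trans w≺v v≺w) (≺-irrefl w)
    ... | yes w≺v | no _    | yes refl = contradiction w≺v (≺-irrefl w)
    ... | no _    | yes v≺w | yes refl = contradiction v≺w (≺-irrefl w)
    ... | no w⊀v  | no v⊀w  | no w≢v with ≺-connex w≢v
    ...   | inj₁ w≺v = contradiction w≺v w⊀v
    ...   | inj₂ v≺w = contradiction v≺w v⊀w

  module LightVertex (v : Fin n) (2fv≤t : f v ℚ.+ f v ℚ.≤ t) where

    private
      d = count (adj G v)
      r = rank v

    notHeavier : Fin n → Bool
    notHeavier w = does (f w ℚ.≤? f v)

    notHeavier⇒≤ : ∀ {w} → notHeavier w ≡ true → f w ℚ.≤ f v
    notHeavier⇒≤ {w} = does-true⇒ (f w ℚ.≤? f v)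

    notHeavier-v : notHeavier v ≡ true
    notHeavier-v = dec-true (f v ℚ.≤? f v) ℚ.≤-refl

    notHeavier⇒neighbour : NeighboursIn G notHeavier (adj G v)
    notHeavier⇒neighbour x y x-light x~y =
      >⇒adjacent v≢y (ℚ.<-≤-trans (adjacent⇒> x~y) (ℚ.+-monoˡ-≤ (f y) (notHeavier⇒≤ x-light)))
      where
      v≢y : v ≢ y
      v≢y refl = ℚ.<-irrefl refl
        (ℚ.<-≤-trans (adjacent⇒> x~y) (ℚ.≤-trans (ℚ.+-monoˡ-≤ (f v) (notHeavier⇒≤ x-light)) 2fv≤t))

    rank<notHeavier : r < count notHeavier
    rank<notHeavier = subst (_≤ count notHeavier) (trans (∑-distrib-+ (b2n ∘ (_≺ᵇ v)) (b2n ∘ (_≟ᵇ v)))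
                        (trans (cong (r +_) (count-≟ᵇ v)) (+-comm r 1)))
                        (sum-mono-≤ lighter-or-v⇒notHeavier)
      where
      lighter-or-v⇒notHeavier : ∀ w → b2n (w ≺ᵇ v) + b2n (w ≟ᵇ v) ≤ b2n (notHeavier w)
      lighter-or-v⇒notHeavier w with w ≺? v | w Fin.≟ v
      ... | yes w≺v | yes refl = contradiction w≺v (≺-irrefl w)
      ... | yes w≺v | no _     rewrite dec-true (f w ℚ.≤? f v) (≺⇒≤ w≺v) = ≤-refl
      ... | no _    | yes refl rewrite notHeavier-v = ≤-refl
      ... | no _    | no _     = z≤n

    light-rank-bound : RankBound n r d
    light-rank-bound = 2r+2<n⇒ , inj₁ (≤-trans rank<notHeavier (count-≤-neighbours notHeavier⇒neighbour))
      where
      2r+2<n⇒ : 2 + (r + r) < n → 2 + r ≤ d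
      2r+2<n⇒ 2r+2<n with uncovered-or-covering notHeavier (adj G v)
      ... | inj₁ (w , w-heavy , v≁w) =
        ≤-trans (s≤s rank<notHeavier) (count-<-neighbours notHeavier⇒neighbour notHeavier-v w-heavy v≁w)
      ... | inj₂ n≤X+d =
        ≤-double⇒rank-bound (≤-trans n≤X+d (+-monoˡ-≤ d (count-≤-neighbours notHeavier⇒neighbour))) 2r+2<n

  module HeavyVertex (v : Fin n) (t<2fv : t ℚ.< f v ℚ.+ f v) where

    private
      d = count (adj G v)
      r = rank v

    nonNeighbour : Fin n → Bool
    nonNeighbour w = not (adj G v w) ∧ not (w ≟ᵇ v)

    heavier : Fin n → Bool
    heavier w = does (f v ℚ.<? f w)

    heavier⇒adjacent : ∀ w → heavier w ≡ true → adj G v w ≡ true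
    heavier⇒adjacent w w-heavy = >⇒adjacent v≢w (ℚ.<-trans t<2fv (ℚ.+-monoʳ-< (f v) fv<fw))
      where
      fv<fw = does-true⇒ (f v ℚ.<? f w) w-heavy
      v≢w : v ≢ w
      v≢w refl = ℚ.<-irrefl refl fv<fw

    nonNeighbour⇒heavier : NeighboursIn G nonNeighbour heavier
    nonNeighbour⇒heavier x y x-non x~y with adj G v x in v~x | x Fin.≟ v
    ... | false | no x≢v = dec-true (f v ℚ.<? f y) (ℚ.≰⇒> fy≰fv)
      where
      fy≰fv : ¬ f y ℚ.≤ f v
      fy≰fv fy≤fv = ℚ.<-irrefl refl (ℚ.<-≤-trans (adjacent⇒> x~y) (ℚ.≤-trans (ℚ.+-monoʳ-≤ (f x) fy≤fv)
                      (ℚ.≤-trans (ℚ.≤-reflexive (ℚ.+-comm (f x) (f v))) (nonadjacent⇒≤ (x≢v ∘ sym) v~x))))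

    nonNeighbours+d+1≡n : count nonNeighbour + d + 1 ≡ n
    nonNeighbours+d+1≡n = count-partition nonNeighbour (adj G v) v one
      where
      one : ∀ w → b2n (nonNeighbour w) + b2n (adj G v w) + b2n (w ≟ᵇ v) ≡ 1
      one w with w Fin.≟ v
      ... | yes refl rewrite irrefl G w = refl
      ... | no  _ with adj G v w
      ...   | true  = refl
      ...   | false = refl

    heavier≤d : count heavier ≤ d
    heavier≤d = sum-mono-≤ heavier≤adjacent
      where
      heavier≤adjacent : ∀ w → b2n (heavier w) ≤ b2n (adj G v w)
      heavier≤adjacent w with heavier w in w-heavy
      ... | false = z≤n
      ... | true  rewrite heavier⇒adjacent w w-heavy = ≤-refl

    heavier≤≻ : count heavier ≤ count (v ≺ᵇ_)
    heavier≤≻ = sum-mono-≤ heavier≤≺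
      where
      heavier≤≺ : ∀ w → b2n (heavier w) ≤ b2n (v ≺ᵇ w)
      heavier≤≺ w with heavier w in w-heavy
      ... | false = z≤n
      ... | true  rewrite dec-true (v ≺? w) (inj₁ (does-true⇒ (f v ℚ.<? f w) w-heavy)) = ≤-refl

    nonNeighbour-v : nonNeighbour v ≡ false
    nonNeighbour-v rewrite irrefl G v | dec-true (v Fin.≟ v) refl = refl

    heavier-v : heavier v ≡ false
    heavier-v = dec-false (f v ℚ.<? f v) (ℚ.<-irrefl refl)

    heavy-rank-bound : RankBound n r d
    heavy-rank-bound with Fin.any? (λ w → nonNeighbour w Bool.≟ true)
    ... | yes (x₀ , x₀-non) = ≤-double⇒rank-bound n≤2d , inj₁ r<d
      where
      non<heavier : count nonNeighbour < count heavier
      non<heavier = count-<-neighbours nonNeighbour⇒heavier x₀-non nonNeighbour-v heavier-v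
      r<d : r < d
      r<d = +-cancelʳ-< (count (v ≺ᵇ_)) r d (begin-strict
        r + count (v ≺ᵇ_)          ≡⟨ +-cancelʳ-≡ 1 _ _ (trans (rank+heavier v) (sym nonNeighbours+d+1≡n)) ⟩
        count nonNeighbour + d     <⟨ +-monoˡ-< d (<-≤-trans non<heavier heavier≤≻) ⟩
        count (v ≺ᵇ_) + d          ≡⟨ +-comm (count (v ≺ᵇ_)) d ⟩
        d + count (v ≺ᵇ_)          ∎)
        where open ≤-Reasoning
      n≤2d : n ≤ d + d
      n≤2d = begin
        n                          ≡⟨ nonNeighbours+d+1≡n ⟨
        count nonNeighbour + d + 1 ≡⟨ +-comm (count nonNeighbour + d) 1 ⟩
        suc (count nonNeighbour + d) ≤⟨ +-monoˡ-≤ d (<-≤-trans non<heavier heavier≤d) ⟩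
        d + d                      ∎
        where open ≤-Reasoning
    ... | no ∄x₀ = 2r+2<n⇒ , inj₂ d+1≡n
      where
      d+1≡n : 1 + d ≡ n
      d+1≡n = trans (+-comm 1 d) (subst (λ x → x + d + 1 ≡ n)
                (count-none nonNeighbour (λ w → Bool.¬-not (∄x₀ ∘ (w ,_)))) nonNeighbours+d+1≡n)
      2r+2<n⇒ : 2 + (r + r) < n → 2 + r ≤ d
      2r+2<n⇒ 2r+2<n = ≤-trans (s≤s (s≤s (m≤m+n r r))) (≤-pred (subst (2 + (r + r) <_) (sym d+1≡n) 2r+2<n))

  rank-bound : ∀ v → RankBound n (rank v) (degree G v)
  rank-bound v = subst (RankBound n (rank v)) (sym (degree≡count G v)) (by-weight (f v ℚ.+ f v ℚ.≤? t))
    where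
    by-weight : Dec (f v ℚ.+ f v ℚ.≤ t) → RankBound n (rank v) (count (adj G v))
    by-weight (yes 2fv≤t) = LightVertex.light-rank-bound v 2fv≤t
    by-weight (no  2fv≰t) = HeavyVertex.heavy-rank-bound v (ℚ.≰⇒> 2fv≰t)

data RankZone (n r : ℕ) : Set where
  low    : 2 + (r + r) < n → RankZone n r
  middle : n ≤ 2 + (r + r) → r + r < n → RankZone n r
  high   : n ≤ r + r → suc r < n → RankZone n r
  top    : n ≤ suc r → RankZone n r

rankZone : ∀ n r → RankZone n r
rankZone n r with 2 + (r + r) <? n | r + r <? n | suc r <? n
... | yes 2r+2<n | _        | _         = low 2r+2<n
... | no  2r+2≮n | yes 2r<n | _         = middle (≮⇒≥ 2r+2≮n) 2r<n
... | no  _      | no  2r≮n | yes r+1<n = high (≮⇒≥ 2r≮n) r+1<n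
... | no  _      | no  _    | no  r+1≮n = top (≮⇒≥ r+1≮n)

-- A bijection of the ranks onto the indices of gnDegree such that gnDegree n (rankIndex n r) is the
-- least degree allowed by RankBound n r.
rankIndex : ℕ → ℕ → ℕ
rankIndex n r with rankZone n r
... | low _      = 2 + r
... | middle _ _ = 0
... | high _ _   = 1 + r
... | top _      = 1

rankIndex<n : ∀ {n r} → 3 ≤ n → rankIndex n r < n
rankIndex<n {n} {r} 3≤n with rankZone n r
... | low 2r+2<n    = ≤-<-trans (s≤s (s≤s (m≤m+n r r))) 2r+2<n
... | middle _ 2r<n = ≤-<-trans z≤n 2r<n
... | high _ r+1<n  = r+1<n
... | top _         = ≤-trans (s≤s (s≤s z≤n)) 3≤n

private
  low≢high : ∀ {n r s} → 2 + (r + r) < n → n ≤ s + s → 2 + r ≢ 1 + s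
  low≢high {n} {r} 2r+2<n n≤2s refl = <-irrefl refl (<-≤-trans 2r+2<n (subst (n ≤_) (suc+suc r) n≤2s))

  middle-unique : ∀ {n r s} → n ≤ 2 + (r + r) → s + s < n → ¬ r < s
  middle-unique {r = r} {s} n≤2r+2 2s<n r<s =
    <-irrefl refl (≤-<-trans n≤2r+2 (≤-<-trans (subst (_≤ s + s) (suc+suc r) (+-mono-≤ r<s r<s)) 2s<n))

rankIndex-injective : ∀ {n r s} → r < n → s < n → rankIndex n r ≡ rankIndex n s → r ≡ s
rankIndex-injective {n} {r} {s} r<n s<n eq with rankZone n r | rankZone n s
... | low _        | low _    = suc-injective (suc-injective eq)
... | low l        | high h _ = contradiction eq (low≢high {r = r} l h)
... | high h _     | low l    = contradiction (sym eq) (low≢high {r = s} l h)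
... | middle l₁ u₁ | middle l₂ u₂ with <-cmp r s
...   | tri< r<s _ _ = contradiction r<s (middle-unique {r = r} {s} l₁ u₂)
...   | tri≈ _ r≡s _ = r≡s
...   | tri> _ _ s<r = contradiction s<r (middle-unique {r = s} {r} l₂ u₁)
rankIndex-injective r<n s<n eq   | high _ _  | high _ _  = suc-injective eq
rankIndex-injective r<n s<n refl | high h _  | top _     = contradiction (<-≤-trans r<n h) λ ()
rankIndex-injective r<n s<n refl | top _     | high h _  = contradiction (<-≤-trans s<n h) λ ()
rankIndex-injective r<n s<n eq   | top n≤r+1 | top n≤s+1 =
  ≤-antisym (≤-pred (≤-trans r<n n≤s+1)) (≤-pred (≤-trans s<n n≤r+1))

gnDegree-suc-≤ : ∀ {n r d} → 3 ≤ n → n ≤ r + r → 1 + r ≤ d → gnDegree n (1 + r) ≤ d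
gnDegree-suc-≤ {r = zero}  3≤n n≤0 _   = contradiction (≤-trans 3≤n n≤0) λ ()
gnDegree-suc-≤ {r = suc _} _   _   r<d = r<d

gnDegree-rankIndex-≤ : ∀ {n r d} → 3 ≤ n → RankBound n r d → gnDegree n (rankIndex n r) ≤ d
gnDegree-rankIndex-≤ {n} {r} {d} 3≤n (2r+2<n⇒ , r<d⊎d+1≡n) with rankZone n r | r<d⊎d+1≡n
... | low 2r+2<n       | _          = 2r+2<n⇒ 2r+2<n
... | middle n≤2r+2 _  | inj₁ r<d   =
  ≤-trans (double≤odd⇒≤ (≤-trans (proj₂ (ceilHalf-bounds n)) (s≤s (subst (n ≤_) (sym (suc+suc r)) n≤2r+2)))) r<d
... | middle _ _       | inj₂ d+1≡n = ≤-pred (subst (ceilHalf n <_) (sym d+1≡n) (ceilHalf<n 3≤n))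
... | high n≤2r _      | inj₁ r<d   = gnDegree-suc-≤ 3≤n n≤2r r<d
... | high n≤2r r+1<n  | inj₂ d+1≡n = gnDegree-suc-≤ 3≤n n≤2r (≤-pred (subst (suc r <_) (sym d+1≡n) r+1<n))
... | top n≤r+1        | inj₁ r<d   = ≤-trans (∸-monoˡ-≤ 1 n≤r+1) (<⇒≤ r<d)
... | top _            | inj₂ d+1≡n = ≤-reflexive (cong (_∸ 1) (sym d+1≡n))

dominates-gnDegrees : 3 ≤ n → (H : Graph n) → IsThreshold H → IsHamiltonian H →
                      Σ (Permutation′ n) λ ρ → ∀ v → gnDegree n (toℕ (ρ ⟨$⟩ʳ v)) ≤ degree H v
dominates-gnDegrees {n} 3≤n H (f , t , _ , _ , threshold) ham = injective⇒permutation index index-injective , bound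
  where
  open ThresholdHamiltonian H f t threshold ham
  index : Fin n → Fin n
  index v = Fin.fromℕ< (rankIndex<n {r = rank v} 3≤n)
  toℕ-index : ∀ v → toℕ (index v) ≡ rankIndex n (rank v)
  toℕ-index v = Fin.toℕ-fromℕ< (rankIndex<n 3≤n)
  index-injective : Injective _≡_ _≡_ index
  index-injective {u} {v} eq = rank-injective (rankIndex-injective (rank<n u) (rank<n v)
    (trans (sym (toℕ-index u)) (trans (cong toℕ eq) (toℕ-index v))))
  bound : ∀ v → gnDegree n (toℕ (index v)) ≤ degree H v
  bound v = subst (λ k → gnDegree n k ≤ degree H v) (sym (toℕ-index v)) (gnDegree-rankIndex-≤ 3≤n (rank-bound v))

module _ (3≤n : 3 ≤ n) (H : Graph n) (H-threshold : IsThreshold H) (H-hamiltonian : IsHamiltonian H) where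

  private
    ρ     = proj₁ (dominates-gnDegrees 3≤n H H-threshold H-hamiltonian)
    bound = proj₂ (dominates-gnDegrees 3≤n H H-threshold H-hamiltonian)
    2≤n   = ≤-trans (n≤1+n 2) 3≤n

  minSize≤size : minSize n ≤ size H
  minSize≤size = *-cancelˡ-≤ 2 (subst₂ _≤_ (sum-gnDegree∘permutation 2≤n ρ) (handshake H) (sum-mono-≤ bound))

  size≡minSize⇒gnDegrees : size H ≡ minSize n →
                           Σ (Permutation′ n) λ ρ → ∀ v → degree H v ≡ gnDegree n (toℕ (ρ ⟨$⟩ʳ v))
  size≡minSize⇒gnDegrees size≡minSize = ρ , λ v → sym (sum-mono-≤-rigid bound (≤-reflexive
    (trans (handshake H) (trans (cong (2 *_) size≡minSize) (sym (sum-gnDegree∘permutation 2≤n ρ))))) v)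

-- Threshold graphs with natural weights

thresholdGraph : (Fin n → ℕ) → ℕ → Graph n
thresholdGraph d t = record
  { adj    = λ u v → not (u ≟ᵇ v) ∧ does (t <? d u + d v)
  ; sym    = λ u v → cong₂ (λ b s → not b ∧ does (t <? s))
                       (does-⇔ (mk⇔ sym sym) (u Fin.≟ v) (v Fin.≟ u)) (+-comm (d u) (d v))
  ; irrefl = λ u → cong (λ b → not b ∧ does (t <? d u + d u)) (dec-true (u Fin.≟ u) refl)
  }

module _ (d : Fin n → ℕ) (t : ℕ) where

  thresholdGraph-adjacent : ∀ {u v} → u ≢ v → t < d u + d v → adj (thresholdGraph d t) u v ≡ true
  thresholdGraph-adjacent {u} {v} u≢v t<s rewrite dec-false (u Fin.≟ v) u≢v | dec-true (t <? d u + d v) t<s = refl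

  thresholdGraph-adjacent⇒ : ∀ {u v} → adj (thresholdGraph d t) u v ≡ true → t < d u + d v
  thresholdGraph-adjacent⇒ {u} {v} u~v with t <? d u + d v
  ... | yes t<s = t<s
  ... | no  t≮s = contradiction (trans (sym u~v) (trans (cong (not (u ≟ᵇ v) ∧_) (dec-false (t <? d u + d v) t≮s))
                                   (Bool.∧-zeroʳ (not (u ≟ᵇ v))))) λ ()

  thresholdGraph-relabel : (π : Permutation′ n) → thresholdGraph (d ∘ (π ⟨$⟩ʳ_)) t ≅ thresholdGraph d t
  thresholdGraph-relabel π = π , λ u v → cong (λ b → not b ∧ does (t <? d (π ⟨$⟩ʳ u) + d (π ⟨$⟩ʳ v)))
    (does-⇔ (mk⇔ (cong (π ⟨$⟩ʳ_)) (permutation-injective π)) (u Fin.≟ v) (π ⟨$⟩ʳ u Fin.≟ π ⟨$⟩ʳ v))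

toℚ : ℕ → ℚ
toℚ zero    = ℚ.0ℚ
toℚ (suc k) = ℚ.1ℚ ℚ.+ toℚ k

toℚ-homo-+ : ∀ a b → toℚ (a + b) ≡ toℚ a ℚ.+ toℚ b
toℚ-homo-+ zero    b = sym (ℚ.+-identityˡ (toℚ b))
toℚ-homo-+ (suc a) b = trans (cong (ℚ.1ℚ ℚ.+_) (toℚ-homo-+ a b)) (sym (ℚ.+-assoc ℚ.1ℚ (toℚ a) (toℚ b)))

toℚ-<-suc : ∀ a → toℚ a ℚ.< toℚ (suc a)
toℚ-<-suc a = subst (ℚ._< toℚ (suc a)) (ℚ.+-identityˡ (toℚ a)) (ℚ.+-monoˡ-< (toℚ a) (from-yes (ℚ.0ℚ ℚ.<? ℚ.1ℚ)))

toℚ-mono-≤ : ∀ {a b} → a ≤ b → toℚ a ℚ.≤ toℚ b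
toℚ-mono-≤ = go ∘ ≤⇒≤′
  where
  go : ∀ {a b} → a ≤′ b → toℚ a ℚ.≤ toℚ b
  go ≤′-refl                    = ℚ.≤-refl
  go {b = suc b} (≤′-step a≤′b) = ℚ.≤-trans (go a≤′b) (ℚ.<⇒≤ (toℚ-<-suc b))

toℚ-mono-< : ∀ {a b} → a < b → toℚ a ℚ.< toℚ b
toℚ-mono-< {a} {b} a<b = ℚ.<-≤-trans (toℚ-<-suc a) (toℚ-mono-≤ {suc a} {b} a<b)

toℚ-cancel-< : ∀ {a b} → toℚ a ℚ.< toℚ b → a < b
toℚ-cancel-< {a} {b} toℚa<toℚb with a <? b
... | yes a<b = a<b
... | no  a≮b = contradiction (ℚ.<-≤-trans toℚa<toℚb (toℚ-mono-≤ (≮⇒≥ a≮b))) (ℚ.<-irrefl refl)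

thresholdGraph-isThreshold : (d : Fin n → ℕ) (t : ℕ) → IsThreshold (thresholdGraph d t)
thresholdGraph-isThreshold d t =
  toℚ ∘ d , toℚ t , (λ u → toℚ-mono-≤ {0} {d u} z≤n) , toℚ-mono-≤ {0} {t} z≤n , λ u v u≢v → mk⇔
    (λ u~v → subst (toℚ t ℚ.<_) (toℚ-homo-+ (d u) (d v)) (toℚ-mono-< (thresholdGraph-adjacent⇒ d t u~v)))
    (λ t<s → thresholdGraph-adjacent d t u≢v (toℚ-cancel-< (subst (toℚ t ℚ.<_) (sym (toℚ-homo-+ (d u) (d v))) t<s)))

-- exchange t a b s ≤ exchange t b a s says ([a] − [b]) · (2s − (2t + 1)) ≤ 0, with both sides moved so
-- that no subtraction occurs.
exchange : ℕ → Bool → Bool → ℕ → ℕ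
exchange t a b s = b2n a * (2 * s) + b2n b * suc (2 * t)

exchange-true-false : ∀ t s → exchange t true false s ≡ 2 * s
exchange-true-false t s = trans (+-identityʳ _) (+-identityʳ _)

exchange-false-true : ∀ t s → exchange t false true s ≡ suc (2 * t)
exchange-false-true t s = +-identityʳ _

exchange-≤ : ∀ t a b s → (b ≡ true → t < s) → (a ≡ true → b ≡ false → s ≤ t) → exchange t a b s ≤ exchange t b a s
exchange-≤ t true  true  s _   _   = ≤-refl
exchange-≤ t false false s _   _   = ≤-refl
exchange-≤ t true  false s _   s≤t = subst₂ _≤_ (sym (exchange-true-false t s)) (sym (exchange-false-true t s))
                                       (≤-trans (*-monoʳ-≤ 2 (s≤t refl refl)) (n≤1+n (2 * t)))
exchange-≤ t false true  s t<s _   = subst₂ _≤_ (sym (exchange-false-true t s)) (sym (exchange-true-false t s))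
                                       (≤-trans (n≤1+n _) (≤-trans (≤-reflexive (sym (*-suc 2 t))) (*-monoʳ-≤ 2 (t<s refl))))

exchange-≡ : ∀ t a b s → exchange t a b s ≡ exchange t b a s → a ≡ b
exchange-≡ t true  true  s _  = refl
exchange-≡ t false false s _  = refl
exchange-≡ t true  false s eq =
  contradiction (trans (sym (exchange-true-false t s)) (trans eq (exchange-false-true t s))) (even≢odd s t)
exchange-≡ t false true  s eq =
  contradiction (trans (sym (exchange-true-false t s)) (trans (sym eq) (exchange-false-true t s))) (even≢odd s t)

sum-exchange : (t : ℕ) (d : Fin n → ℕ) (G H : Graph n) → (∀ u → degree G u ≡ d u) → (∀ u → degree H u ≡ d u) →
               sum₂ (λ u v → exchange t (adj G u v) (adj H u v) (d u + d v))
                 ≡ 2 * sum (λ u → d u * (2 * d u)) + sum d * suc (2 * t)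
sum-exchange t d G H G-degree H-degree = begin
  sum₂ (λ u v → exchange t (adj G u v) (adj H u v) (d u + d v))
    ≡⟨ sum-cong-≗ (λ u → sum-cong-≗ (λ v → cong (λ x → [G] u v * x + [H] u v * K) (*-distribˡ-+ 2 (d u) (d v)))) ⟩
  sum₂ (λ u v → [G] u v * (w u + w v) + [H] u v * K)
    ≡⟨ sum₂-distrib-+ (λ u v → [G] u v * (w u + w v)) (λ u v → [H] u v * K) ⟩
  sum₂ (λ u v → [G] u v * (w u + w v)) + sum₂ (λ u v → [H] u v * K)
    ≡⟨ cong₂ _+_ (sum₂-adj-weighted G w) (sum₂-*ʳ [H] K) ⟩
  2 * sum (λ u → degree G u * w u) + sum₂ [H] * K
    ≡⟨ cong₂ (λ x y → 2 * x + y * K) (sum-cong-≗ (λ u → cong (_* w u) (G-degree u)))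
                                     (trans (sum₂-adj H) (sum-cong-≗ H-degree)) ⟩
  2 * sum (λ u → d u * w u) + sum d * K ∎
  where
  open ≡-Reasoning
  K = suc (2 * t)
  w = λ u → 2 * d u
  [G] [H] : _ → _ → ℕ
  [G] u v = b2n (adj G u v)
  [H] u v = b2n (adj H u v)

-- Summing exchange over all pairs gives the same total in both orders, since A and the threshold graph
-- have the same degrees; as each term of one order is ≤ the other, they agree termwise.
thresholdGraph-unique : (d : Fin n → ℕ) (t : ℕ) → (∀ u → degree (thresholdGraph d t) u ≡ d u) →
                        (A : Graph n) → (∀ u → degree A u ≡ d u) → ∀ u v → adj A u v ≡ adj (thresholdGraph d t) u v
thresholdGraph-unique {n} d t T-degree A A-degree u v =
  exchange-≡ t (adj A u v) (adj T u v) (d u + d v) (exchange-balanced u v)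
  where
  T = thresholdGraph d t
  A∧¬T⇒s≤t : ∀ u v → adj A u v ≡ true → adj T u v ≡ false → d u + d v ≤ t
  A∧¬T⇒s≤t u v u~v u≁v = ≮⇒≥ λ t<s → contradiction (trans (sym u≁v) (thresholdGraph-adjacent d t u≢v t<s)) λ ()
    where
    u≢v : u ≢ v
    u≢v refl = contradiction (trans (sym u~v) (irrefl A u)) λ ()
  exchange-balanced : ∀ u v → exchange t (adj A u v) (adj T u v) (d u + d v) ≡ exchange t (adj T u v) (adj A u v) (d u + d v)
  exchange-balanced = sum₂-mono-≤-rigid
    (λ u v → exchange-≤ t (adj A u v) (adj T u v) (d u + d v) (thresholdGraph-adjacent⇒ d t) (A∧¬T⇒s≤t u v))
    (≤-reflexive (trans (sum-exchange t d T A T-degree A-degree) (sym (sum-exchange t d A T A-degree T-degree))))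

-- The graph G_n

gnGraph : (n : ℕ) → Graph n
gnGraph n = thresholdGraph (gnDegree n ∘ toℕ) n

gnGraph-partners : ∀ {m x} → 2 ≤ x → x ≤ suc m →
  count {2 + m} (λ k → does (2 + m <? x + gnDegree (2 + m) (toℕ k))) ≡ x + b2n (does (2 + m <? x + x))
gnGraph-partners {m} {suc y} (s≤s 1≤y) x≤m+1 = begin
  b2n (does (N <? x + c)) + (b2n (does (N <? x + suc m)) + rest)
    ≡⟨ cong₂ (λ a b → a + (b + rest)) (cong b2n (does-⇔ (ceilHalf-partner N x) (N <? x + c) (N <? x + x)))
                                      (cong b2n (dec-true (N <? x + suc m) N<x+m+1)) ⟩
  b2n (does (N <? x + x)) + (1 + rest)
    ≡⟨ cong (λ a → b2n (does (N <? x + x)) + (1 + a)) (trans (sum-cong-≗ {m} shift) (count-≥ m (m ∸ y))) ⟩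
  b2n (does (N <? x + x)) + (1 + (m ∸ (m ∸ y)))
    ≡⟨ cong (λ a → b2n (does (N <? x + x)) + suc a) (m∸[m∸n]≡n (s≤s⁻¹ x≤m+1)) ⟩
  b2n (does (N <? x + x)) + x        ≡⟨ +-comm _ x ⟩
  x + b2n (does (N <? x + x))        ∎
  where
  open ≡-Reasoning
  N = 2 + m
  x = suc y
  c = ceilHalf N
  rest = sum {m} (λ k → b2n (does (N <? x + (2 + toℕ k))))
  N<x+m+1 : N < x + suc m
  N<x+m+1 = s≤s (subst (2 + m ≤_) (sym (+-suc y m)) (s≤s (+-monoˡ-≤ m 1≤y)))
  x+2+k≡ : ∀ k → x + (2 + k) ≡ 3 + (y + k)
  x+2+k≡ k = cong suc (trans (+-suc y (suc k)) (cong suc (+-suc y k)))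
  shift : ∀ k → b2n (does (N <? x + (2 + toℕ k))) ≡ b2n (does (m ∸ y ≤? toℕ k))
  shift k = cong b2n (does-⇔ (mk⇔ to from) (N <? x + (2 + toℕ k)) (m ∸ y ≤? toℕ k))
    where
    to : N < x + (2 + toℕ k) → m ∸ y ≤ toℕ k
    to N<x+2+k = m≤n+o⇒m∸n≤o m y (s≤s⁻¹ (s≤s⁻¹ (s≤s⁻¹ (subst (N <_) (x+2+k≡ (toℕ k)) N<x+2+k))))
    from : m ∸ y ≤ toℕ k → N < x + (2 + toℕ k)
    from m∸y≤k = subst (N <_) (sym (x+2+k≡ (toℕ k)))
                   (s≤s (s≤s (s≤s (≤-trans (m≤n+m∸n m y) (+-monoʳ-≤ y m∸y≤k)))))

degree-gnGraph : 3 ≤ n → ∀ u → degree (gnGraph n) u ≡ gnDegree n (toℕ u)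
degree-gnGraph {suc (suc m)} 3≤n@(s≤s (s≤s _)) u = +-cancelʳ-≡ (b2n (P u)) _ _ (begin
  degree (gnGraph (2 + m)) u + b2n (P u)        ≡⟨ cong (_+ b2n (P u)) (degree≡count (gnGraph (2 + m)) u) ⟩
  count (λ v → not (u ≟ᵇ v) ∧ P v) + b2n (P u) ≡⟨ count-except P u ⟩
  count P                                      ≡⟨ gnGraph-partners (proj₁ x-range) (s≤s⁻¹ (proj₂ x-range)) ⟩
  x + b2n (P u)                                ∎)
  where
  open ≡-Reasoning
  x = gnDegree (2 + m) (toℕ u)
  x-range = gnDegree-range 3≤n (toℕ u) (Fin.toℕ<n u)
  P : Fin (2 + m) → Bool
  P v = does (2 + m <? x + gnDegree (2 + m) (toℕ v))

size-gnGraph : 3 ≤ n → size (gnGraph n) ≡ minSize n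
size-gnGraph {n} 3≤n = *-cancelˡ-≡ _ _ 2 (begin
  2 * size (gnGraph n)          ≡⟨ handshake (gnGraph n) ⟨
  sum (degree (gnGraph n))      ≡⟨ sum-cong-≗ (degree-gnGraph 3≤n) ⟩
  sum {n} (gnDegree n ∘ toℕ)    ≡⟨ sum-gnDegree (≤-trans (n≤1+n 2) 3≤n) ⟩
  2 * minSize n                 ∎)
  where open ≡-Reasoning

gnGraph-isGn : 3 ≤ n → IsGn (gnGraph n)
gnGraph-isGn {n} 3≤n =
  ↭-trans (↭-reflexive (trans (degreeList≡tabulate (gnGraph n)) (List.tabulate-cong (degree-gnGraph 3≤n))))
          (gnDegrees↭degSeqGn (≤-trans (n≤1+n 2) 3≤n))

gnDegrees⇒≅gnGraph : 3 ≤ n → (A : Graph n) (ρ : Permutation′ n) →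
                     (∀ v → degree A v ≡ gnDegree n (toℕ (ρ ⟨$⟩ʳ v))) → A ≅ gnGraph n
gnDegrees⇒≅gnGraph {n} 3≤n A ρ A-degree =
  ≅-trans {F = A} {T} {gnGraph n} (≅-of-≡ {H = A} {T} (thresholdGraph-unique d n T-degree A A-degree)) relabel
  where
  d = gnDegree n ∘ toℕ ∘ (ρ ⟨$⟩ʳ_)
  T = thresholdGraph d n
  relabel : T ≅ gnGraph n
  relabel = thresholdGraph-relabel (gnDegree n ∘ toℕ) n ρ
  T-degree : ∀ u → degree T u ≡ d u
  T-degree u = trans (degree-≅ {H = T} {gnGraph n} relabel u) (degree-gnGraph 3≤n (ρ ⟨$⟩ʳ u))

-- For n = 3 + L the cycle visits the vertices of degree ⌈n/2⌉ and n − 1 (indices 0 and 1), then the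
-- vertices of degree 2 + zig p for p = 0 … L, i.e. the degrees 2, n − 1, 3, n − 2, 4, …
module Zigzag (L : ℕ) where

  zig : ℕ → ℕ
  zig p with p % 2
  ... | 0 = p / 2
  ... | _ = L ∸ p / 2

  zig-even : ∀ q → zig (q + q) ≡ q
  zig-even q with (q + q) % 2 | [q+q]%2≡0 q
  ... | .0 | refl = [q+q]/2≡q q

  zig-odd : ∀ q → zig (suc (q + q)) ≡ L ∸ q
  zig-odd q with suc (q + q) % 2 | [1+q+q]%2≡1 q
  ... | .1 | refl = cong (L ∸_) ([1+q+q]/2≡q q)

  zig-even′ : ∀ q → zig (suc (suc (q + q))) ≡ suc q
  zig-even′ q = trans (cong (zig ∘ suc) (sym (+-suc q q))) (zig-even (suc q))

  zig-≤ : ∀ {p} → p ≤ L → zig p ≤ L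
  zig-≤ {p} p≤L with evenOdd p
  ... | even q rewrite zig-even q = ≤-trans (m≤m+n q q) p≤L
  ... | odd  q rewrite zig-odd q  = m∸n≤m L q

  zig-step : ∀ {p} → suc p ≤ L → L ≤ zig p + zig (suc p)
  zig-step {p} p+1≤L with evenOdd p
  ... | even q = ≤-reflexive (sym (trans (cong₂ _+_ (zig-even q) (zig-odd q)) (m+[n∸m]≡n q≤L)))
    where q≤L = ≤-trans (m≤m+n q q) (≤-trans (n≤1+n _) p+1≤L)
  ... | odd  q = ≤-trans (n≤1+n L) (≤-reflexive (sym (begin
    zig (suc (q + q)) + zig (suc (suc (q + q))) ≡⟨ cong₂ _+_ (zig-odd q) (zig-even′ q) ⟩
    L ∸ q + suc q                               ≡⟨ +-suc (L ∸ q) q ⟩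
    suc (L ∸ q + q)                             ≡⟨ cong suc (m∸n+n≡m q≤L) ⟩
    suc L                                       ∎)))
    where
    open ≡-Reasoning
    q≤L = ≤-trans (m≤m+n q q) (≤-trans (n≤1+n _) (≤-trans (n≤1+n _) p+1≤L))

  zig-last : L + 2 ≤ zig L + ceilHalf (3 + L)
  zig-last with evenOdd L
  ... | even q = ≤-reflexive (begin
    q + q + 2                              ≡⟨ even-sum q ⟩
    q + suc (suc q)                        ≡⟨ cong₂ _+_ (zig-even q) (trans (cong ceilHalf (three+ q)) (ceilHalf-odd (suc q))) ⟨
    zig (q + q) + ceilHalf (3 + (q + q))   ∎)
    where
    open ≡-Reasoning
    even-sum : ∀ q → q + q + 2 ≡ q + suc (suc q)
    even-sum = solve-∀
    three+ : ∀ q → 3 + (q + q) ≡ suc (suc q + suc q)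
    three+ = solve-∀
  ... | odd  q = ≤-reflexive (begin
    suc (q + q) + 2                                ≡⟨ odd-sum q ⟩
    suc q + suc (suc q)                            ≡⟨ cong₂ _+_ (trans (zig-odd q) (m+n∸n≡m (suc q) q))
                                                               (trans (cong ceilHalf (four+ q)) (ceilHalf-even (suc (suc q)))) ⟨
    zig (suc (q + q)) + ceilHalf (3 + suc (q + q)) ∎)
    where
    open ≡-Reasoning
    odd-sum : ∀ q → suc (q + q) + 2 ≡ suc q + suc (suc q)
    odd-sum = solve-∀
    four+ : ∀ q → 3 + suc (q + q) ≡ suc (suc q) + suc (suc q)
    four+ = solve-∀

  even≢odd-zig : ∀ {q q′} → q + q ≤ L → suc (q′ + q′) ≤ L → q ≢ L ∸ q′
  even≢odd-zig {q} {q′} 2q≤L 2q′+1≤L q≡L∸q′ = contradiction (+-mono-≤ 2q≤L 2q′+1≤L) (<⇒≱ (≤-reflexive (begin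
    suc (L + L)                   ≡⟨ cong (λ l → suc (l + l)) (trans (cong (_+ q′) q≡L∸q′) (m∸n+n≡m q′≤L)) ⟨
    suc ((q + q′) + (q + q′))     ≡⟨ regroup q q′ ⟩
    q + q + suc (q′ + q′)         ∎)))
    where
    open ≡-Reasoning
    q′≤L = ≤-trans (m≤m+n q′ q′) (≤-trans (n≤1+n _) 2q′+1≤L)
    regroup : ∀ q q′ → suc ((q + q′) + (q + q′)) ≡ q + q + suc (q′ + q′)
    regroup = solve-∀

  zig-injective : ∀ {p p′} → p ≤ L → p′ ≤ L → zig p ≡ zig p′ → p ≡ p′
  zig-injective {p} {p′} p≤L p′≤L eq with evenOdd p | evenOdd p′
  ... | even q | even q′ = cong (λ x → x + x) (trans (sym (zig-even q)) (trans eq (zig-even q′)))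
  ... | odd  q | odd  q′ = cong (λ x → suc (x + x)) (∸-cancelˡ-≡ (half≤ q p≤L) (half≤ q′ p′≤L)
                             (trans (sym (zig-odd q)) (trans eq (zig-odd q′))))
    where
    half≤ : ∀ q → suc (q + q) ≤ L → q ≤ L
    half≤ q h = ≤-trans (m≤m+n q q) (≤-trans (n≤1+n _) h)
  ... | even q | odd  q′ = contradiction (trans (sym (zig-even q)) (trans eq (zig-odd q′)))
                             (even≢odd-zig {q} {q′} p≤L p′≤L)
  ... | odd  q | even q′ = contradiction (trans (sym (zig-even q′)) (trans (sym eq) (zig-odd q)))
                             (even≢odd-zig {q′} {q} p′≤L p≤L)

  cycle : ℕ → ℕ
  cycle 0             = 0
  cycle 1             = 1
  cycle (suc (suc p)) = suc (suc (zig p))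

  cycle-< : ∀ {p} → p < 3 + L → cycle p < 3 + L
  cycle-< {0}           _     = s≤s z≤n
  cycle-< {1}           _     = s≤s (s≤s z≤n)
  cycle-< {suc (suc p)} p+2<n = s≤s (s≤s (s≤s (zig-≤ (s≤s⁻¹ (s≤s⁻¹ (s≤s⁻¹ p+2<n))))))

  cycle-injective : ∀ {p p′} → p < 3 + L → p′ < 3 + L → cycle p ≡ cycle p′ → p ≡ p′
  cycle-injective {0}           {0}            _ _ _ = refl
  cycle-injective {1}           {1}            _ _ _ = refl
  cycle-injective {0}           {1}            _ _ ()
  cycle-injective {0}           {suc (suc _)}  _ _ ()
  cycle-injective {1}           {0}            _ _ ()
  cycle-injective {1}           {suc (suc _)}  _ _ ()
  cycle-injective {suc (suc _)} {0}            _ _ ()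
  cycle-injective {suc (suc _)} {1}            _ _ ()
  cycle-injective {suc (suc p)} {suc (suc p′)} p+2<n p′+2<n eq = cong (λ x → suc (suc x))
    (zig-injective (s≤s⁻¹ (s≤s⁻¹ (s≤s⁻¹ p+2<n))) (s≤s⁻¹ (s≤s⁻¹ (s≤s⁻¹ p′+2<n)))
                   (suc-injective (suc-injective eq)))

  private
    D : ℕ → ℕ
    D = gnDegree (3 + L)

  cycle-adjacent-suc : ∀ {p} → suc p < 3 + L → 3 + L < D (cycle p) + D (cycle (suc p))
  cycle-adjacent-suc {0}           _     = +-monoˡ-≤ (2 + L) (proj₁ (gnDegree-range {3 + L} (s≤s (s≤s (s≤s z≤n))) 0 z<s))
  cycle-adjacent-suc {1}           _     = ≤-reflexive (sym (+-comm (2 + L) 2))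
  cycle-adjacent-suc {suc (suc p)} p+3<n = ≤-trans (s≤s (s≤s (s≤s (s≤s (zig-step (s≤s⁻¹ (s≤s⁻¹ (s≤s⁻¹ p+3<n))))))))
                                                  (≤-reflexive (regroup (zig p) (zig (suc p))))
    where
    regroup : ∀ a b → 4 + (a + b) ≡ (2 + a) + (2 + b)
    regroup = solve-∀

  cycle-adjacent-wrap : 3 + L < D (cycle (2 + L)) + D (cycle 0)
  cycle-adjacent-wrap = subst (_≤ 2 + (zig L + ceilHalf (3 + L))) (four+ L) (s≤s (s≤s zig-last))
    where
    four+ : ∀ L → 2 + (L + 2) ≡ 4 + L
    four+ = solve-∀

  cycle-adjacent : ∀ {p q} → p < 3 + L → suc p % (3 + L) ≡ q → p ≢ q × 3 + L < D (cycle p) + D (cycle q)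
  cycle-adjacent {p} {q} p<n p+1%n≡q with m≤n⇒m<n∨m≡n p<n
  ... | inj₁ p+1<n rewrite sym p+1%n≡q | m<n⇒m%n≡m p+1<n = 1+n≢n ∘ sym , cycle-adjacent-suc p+1<n
  ... | inj₂ p+1≡n = (λ p≡q → contradiction (trans (sym p≡2+L) (trans p≡q q≡0)) λ ()) ,
                     subst₂ (λ a b → 3 + L < D (cycle a) + D (cycle b)) (sym p≡2+L) (sym q≡0) cycle-adjacent-wrap
    where
    p≡2+L : p ≡ 2 + L
    p≡2+L = suc-injective p+1≡n
    q≡0 : q ≡ 0
    q≡0 = trans (sym p+1%n≡q) (trans (cong (_% (3 + L)) p+1≡n) (n%n≡0 (3 + L)))

  gnGraph-isHamiltonian : IsHamiltonian (gnGraph (3 + L))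
  gnGraph-isHamiltonian = injective⇒permutation σ σ-injective , σ-adjacent
    where
    σ : Fin (3 + L) → Fin (3 + L)
    σ i = Fin.fromℕ< (cycle-< (Fin.toℕ<n i))
    toℕ-σ : ∀ i → toℕ (σ i) ≡ cycle (toℕ i)
    toℕ-σ i = Fin.toℕ-fromℕ< (cycle-< (Fin.toℕ<n i))
    σ-injective : Injective _≡_ _≡_ σ
    σ-injective {i} {j} eq = Fin.toℕ-injective
      (cycle-injective (Fin.toℕ<n i) (Fin.toℕ<n j) (trans (sym (toℕ-σ i)) (trans (cong toℕ eq) (toℕ-σ j))))
    σ-adjacent : ∀ i j → modn (suc (toℕ i)) (3 + L) ≡ toℕ j → adj (gnGraph (3 + L)) (σ i) (σ j) ≡ true
    σ-adjacent i j i+1≡j with cycle-adjacent (Fin.toℕ<n i) i+1≡j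
    ... | i≢j , n<Di+Dj = thresholdGraph-adjacent (gnDegree (3 + L) ∘ toℕ) (3 + L) (i≢j ∘ cong toℕ ∘ σ-injective)
      (subst (3 + L <_) (sym (cong₂ (λ a b → D a + D b) (toℕ-σ i) (toℕ-σ j))) n<Di+Dj)

theorem7 : (n : ℕ) → 3 ≤ n →
    (Σ (Graph n) λ G → IsThreshold G × IsHamiltonian G × size G ≡ minSize n × IsGn G)
    × (∀ (H : Graph n) → IsThreshold H → IsHamiltonian H → minSize n ≤ size H)
    × (∀ (H : Graph n) → IsThreshold H → IsHamiltonian H → size H ≡ minSize n →
         ∀ (G : Graph n) → IsGn G → H ≅ G)
theorem7 n@(suc (suc (suc L))) 3≤n@(s≤s (s≤s (s≤s _))) =
  (gnGraph n , thresholdGraph-isThreshold (gnDegree n ∘ toℕ) n , Zigzag.gnGraph-isHamiltonian L ,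
   size-gnGraph 3≤n , gnGraph-isGn 3≤n) ,
  minSize≤size 3≤n ,
  λ H H-threshold H-hamiltonian size≡minSize G G-isGn →
    let (ρH , H-degrees) = size≡minSize⇒gnDegrees 3≤n H H-threshold H-hamiltonian size≡minSize
        (ρG , G-degrees) = isGn⇒gnDegrees (s≤s (s≤s z≤n)) G G-isGn
    in  ≅-trans {F = H} {gnGraph n} {G} (gnDegrees⇒≅gnGraph 3≤n H ρH H-degrees)
                (≅-sym {H = G} {gnGraph n} (gnDegrees⇒≅gnGraph 3≤n G ρG G-degrees))
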